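{- Let $G$ be a difference graph with vertex-eigenvector $(x_1,\ldots,x_k;y_1,\ldots,y_k)$, $k\ge 1$, and let $T=(t_{pq})_{k\times k}$ be its characteristic matrix. Then $$\mathbf{a}_4(G)=\sum_{i=1}^{k-1}\Big(\sum_{p=1}^{k} t_{p,\,k-i+1}\Big)\Big(\sum_{p=i+1}^{k}\sum_{q=1}^{k-i} t_{pq}\Big).$$
   Context: All graphs are finite, simple and undirected. For a graph $G$ on $n$ vertices with adjacency matrix $\mathbf{A}(G)$, write $\det(\lambda I-\mathbf{A}(G))=\sum_{i=0}^n \mathbf{a}_i(G)\lambda^{n-i}$, so $\mathbf{a}_4(G)$ is the coefficient of $\lambda^{n-4}$. A difference graph with vertex bipartition $(X_1,\ldots,X_k;Y_1,\ldots,Y_k)$ is a graph whose vertex set is the disjoint union of nonempty sets $X_1,\ldots,X_k,Y_1,\ldots,Y_k$ and in which $x\in X_i$ and $y\in Y_j$ are adjacent if and only if $i+j\le k+1$, with no edges inside $X=\bigcup X_i$ or inside $Y=\bigcup Y_j$ (so each vertex of $X_i$ has neighborhood $Y_1\cup\cdots\cup Y_{k-i+1}$ and each vertex of $Y_i$ has neighborhood $X_1\cup\cdots\cup X_{k-i+1}$). Its vertex-eigenvector is $(x_1,\ldots,x_k;y_1,\ldots,y_k)$ with $x_i=|X_i|$, $y_i=|Y_i|$. The characteristic matrix $T=(t_{pq})_{k\times k}$ is defined by $t_{pq}=x_py_q$ if $p+q\le k+1$ and $t_{pq}=0$ otherwise. -}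

module Defs where

open import Data.Nat using (ℕ; zero; suc; _+_; _*_; _∸_; _≤_; _≤ᵇ_; _≤?_)
open import Data.Integer as ℤ using (ℤ; +_; -_)
open import Data.Fin using (Fin; zero; suc; punchIn; _≟_)
open import Data.List using (List; []; _∷_)
open import Data.Bool using (Bool; true; false; if_then_else_)
open import Data.Product using (_×_; Σ; _,_)
open import Relation.Binary.PropositionalEquality using (_≡_; _≢_)
open import Relation.Nullary using (yes; no; Dec)
open import Function.Bundles using (_⇔_)

sumFin : ∀ {n} → (Fin n → ℕ) → ℕ
sumFin {zero}  f = 0
sumFin {suc n} f = f zero + sumFin (λ i → f (suc i))

-- Σ_{i=a}^{b} f i  (ℕ indices, empty if b < a); computed as Σ_{j<b+1-a} f (a+j)
sumRange-aux : ℕ → ℕ → (ℕ → ℕ) → ℕ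
sumRange-aux a zero    f = 0
sumRange-aux a (suc m) f = f a + sumRange-aux (suc a) m f

sumFrom_to_of_ : ℕ → ℕ → (ℕ → ℕ) → ℕ
sumFrom a to b of f = sumRange-aux a (suc b ∸ a) f

-- Polynomials over ℤ as coefficient lists (ascending powers)

Poly : Set
Poly = List ℤ

_+ₚ_ : Poly → Poly → Poly
[]       +ₚ q        = q
(a ∷ p)  +ₚ []       = a ∷ p
(a ∷ p)  +ₚ (b ∷ q)  = (a ℤ.+ b) ∷ (p +ₚ q)

scaleₚ : ℤ → Poly → Poly
scaleₚ c []      = []
scaleₚ c (a ∷ p) = (c ℤ.* a) ∷ scaleₚ c p

-ₚ_ : Poly → Poly
-ₚ p = scaleₚ (- (+ 1)) p

_*ₚ_ : Poly → Poly → Poly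
[]      *ₚ q = []
(a ∷ p) *ₚ q = scaleₚ a q +ₚ (+ 0 ∷ (p *ₚ q))

constₚ : ℤ → Poly
constₚ c = c ∷ []

varₚ : Poly
varₚ = + 0 ∷ + 1 ∷ []

coeff : Poly → ℕ → ℤ
coeff []      m       = + 0
coeff (a ∷ p) zero    = a
coeff (a ∷ p) (suc m) = coeff p m

sumFinₚ : ∀ {n} → (Fin n → Poly) → Poly
sumFinₚ {zero}  f = []
sumFinₚ {suc n} f = f zero +ₚ sumFinₚ (λ i → f (suc i))

sign : ∀ {n} → Fin n → Poly → Poly
sign zero          p = p
sign (suc zero)    p = -ₚ p
sign (suc (suc j)) p = sign j p

det : ∀ {n} → (Fin n → Fin n → Poly) → Poly
det {zero}  M = constₚ (+ 1)
det {suc n} M = sumFinₚ (λ j → sign j (M zero j *ₚ det (λ r c → M (suc r) (punchIn j c))))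

record Graph (n : ℕ) : Set where
  field
    adj   : Fin n → Fin n → Bool
    sym   : ∀ u v → adj u v ≡ adj v u
    irrefl : ∀ u → adj u u ≡ false

open Graph public

adjMatrix : ∀ {n} → Graph n → Fin n → Fin n → ℤ
adjMatrix G u v = if adj G u v then + 1 else + 0

charPoly : ∀ {n} → Graph n → Poly
charPoly {n} G = det (λ u v → idλ u v +ₚ (-ₚ constₚ (adjMatrix G u v)))
  where
  idλ : Fin n → Fin n → Poly
  idλ u v with u ≟ v
  ... | yes _ = varₚ
  ... | no  _ = []

-- a_i(G) : coefficient of λ^(n-i) (zero when i > n)
a : ∀ {n} → ℕ → Graph n → ℤ
a {n} i G with i ≤? n
... | yes _ = coeff (charPoly G) (n ∸ i)
... | no  _ = + 0

data Side : Set where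
  sideX sideY : Side

-- A labelling of the vertices: vertex v lies in X_i (side = sideX, index = i)
-- or in Y_i (side = sideY, index = i), with 1 ≤ i ≤ k.
record DiffLabelling {n : ℕ} (k : ℕ) (G : Graph n) : Set where
  field
    side  : Fin n → Side
    index : Fin n → ℕ
    index-pos : ∀ v → 1 ≤ index v
    index-le  : ∀ v → index v ≤ k
    nonemptyX : ∀ i → 1 ≤ i → i ≤ k → Σ (Fin n) (λ v → side v ≡ sideX × index v ≡ i)
    nonemptyY : ∀ i → 1 ≤ i → i ≤ k → Σ (Fin n) (λ v → side v ≡ sideY × index v ≡ i)
    adj-iff : ∀ u v → (adj G u v ≡ true) ⇔ (side u ≢ side v × index u + index v ≤ suc k)

open DiffLabelling public

isSide : Side → Side → Bool
isSide sideX sideX = true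
isSide sideY sideY = true
isSide _     _     = false

-- x_i = |X_i|, y_i = |Y_i|
xCount : ∀ {n k} {G : Graph n} → DiffLabelling k G → ℕ → ℕ
xCount L i = sumFin (λ v → if isSide (side L v) sideX then (if (index L v ≤ᵇ i) Data.Bool.∧ (i ≤ᵇ index L v) then 1 else 0) else 0)
  where import Data.Bool

yCount : ∀ {n k} {G : Graph n} → DiffLabelling k G → ℕ → ℕ
yCount L i = sumFin (λ v → if isSide (side L v) sideY then (if (index L v ≤ᵇ i) Data.Bool.∧ (i ≤ᵇ index L v) then 1 else 0) else 0)
  where import Data.Bool

-- characteristic matrix entries t_{pq} (1-based indices)
charMat : ∀ {n k} {G : Graph n} → DiffLabelling k G → ℕ → ℕ → ℕ
charMat {k = k} L p q = if p + q ≤ᵇ suc k then xCount L p * yCount L q else 0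

module Submission where

-- Expanding det (λI − A) multilinearly in the rows, a₄ is the sum of the 4 × 4 principal minors
-- of −A. For a simple graph the minor on a, b, c, d is ψ(A_ab A_cd, A_ac A_bd, A_ad A_bc) with
-- ψ(p, q, r) = p² + q² + r² − 2(pq + pr + qr); this is symmetric and vanishes when two of the
-- vertices coincide, so summing it over all ordered quadruples counts each 4-set 24 times and
-- gives 24 a₄ = 3 (Σ A)² − 6 tr A⁴. For a difference graph Σ A = 2P and tr A⁴ = 2Q, where
-- P = Σ_{i+j≤k+1} x_i y_j counts edges and Q counts closed walks X–Y–X–Y. The neighbourhoods are
-- nested, so of two edges ij, i′j′ at least one of i′j, ij′ is again an edge; hence P² − Q counts
-- the pairs of edges ij, i′j′ for which exactly one of i′j, ij′ is missing. The two kinds are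
-- equinumerous, and sorting those with i′j missing by j gives the stated sum, so
-- 24 a₄ = 12 (P² − Q) is 24 times it.

module CharacteristicPolynomial where

  open import Data.Bool using (Bool; true; false; if_then_else_)
  open import Data.Empty using (⊥-elim)
  open import Data.Fin using (Fin; zero; suc; punchIn; _≟_)
  open import Data.Fin.Patterns using (0F; 1F; 2F; 3F)
  open import Data.Fin.Properties using (punchIn-injective; punchInᵢ≢i)
  open import Data.Integer using (ℤ; +_; -_; _+_; _*_; _-_)
  import Data.Integer.Properties as ℤ
  open import Data.Integer.Tactic.RingSolver using (solve-∀)
  open import Data.List using (_∷_; [])
  open import Data.Nat as ℕ using (ℕ; zero; suc; _≤_; s≤s; _∸_; _≤?_)
  import Data.Nat.Properties as ℕ
  import Data.Vec.Functional as Vector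
  open import Data.Product using (Σ; _,_; proj₁)
  open import Data.Sum using ([_,_]′)
  open import Function using (_∘_)
  open import Relation.Binary.PropositionalEquality
  open import Relation.Nullary using (yes; no; does)

  open import Algebra.Properties.Semiring.Sum ℤ.+-*-semiring
    using (sum; sum-cong-≋; ∑-distrib-+; ∑-comm; sum-remove; *-distribˡ-sum; *-distribʳ-sum; sum-replicate-zero)

  open import Defs using (Poly; _+ₚ_; scaleₚ; _*ₚ_; coeff; sumFinₚ; sign; det; Graph; adj; adjMatrix; charPoly; a)

  sum-zero : ∀ {n} {f : Fin n → ℤ} → (∀ i → f i ≡ + 0) → sum f ≡ + 0
  sum-zero {n} f≡0 = trans (sum-cong-≋ f≡0) (sum-replicate-zero n)

  sgn : ∀ {n} → Fin n → ℤ
  sgn zero          = + 1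
  sgn (suc zero)    = - + 1
  sgn (suc (suc j)) = sgn j

  sgn-suc : ∀ {n} (j : Fin n) → sgn (suc j) ≡ - sgn j
  sgn-suc zero          = refl
  sgn-suc (suc zero)    = refl
  sgn-suc (suc (suc j)) = sgn-suc j

  sgn*sgn : ∀ {n} (j : Fin n) → sgn j * sgn j ≡ + 1
  sgn*sgn zero          = refl
  sgn*sgn (suc zero)    = refl
  sgn*sgn (suc (suc j)) = sgn*sgn j

  minor : ∀ {n} {A : Set} → (Fin (suc n) → Fin (suc n) → A) → Fin (suc n) → Fin (suc n) → Fin n → Fin n → A
  minor M r c i j = M (punchIn r i) (punchIn c j)

  detℤ : ∀ {n} → (Fin n → Fin n → ℤ) → ℤ
  detℤ {zero}  M = + 1
  detℤ {suc n} M = sum λ j → sgn j * (M zero j * detℤ (minor M zero j))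

  detℤ-cong : ∀ {n} {M N : Fin n → Fin n → ℤ} → (∀ r c → M r c ≡ N r c) → detℤ M ≡ detℤ N
  detℤ-cong {zero}  M≡N = refl
  detℤ-cong {suc n} M≡N = sum-cong-≋ λ j →
    cong₂ (λ m d → sgn j * (m * d)) (M≡N zero j) (detℤ-cong λ r c → M≡N (suc r) (punchIn j c))

  laplaceTerm-entry≡0 : ∀ s {m} d → m ≡ + 0 → s * (m * d) ≡ + 0
  laplaceTerm-entry≡0 s d refl = trans (cong (s *_) (ℤ.*-zeroˡ d)) (ℤ.*-zeroʳ s)

  laplaceTerm-minor≡0 : ∀ s m {d} → d ≡ + 0 → s * (m * d) ≡ + 0
  laplaceTerm-minor≡0 s m refl = trans (cong (s *_) (ℤ.*-zeroʳ m)) (ℤ.*-zeroʳ s)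

  negate : ∀ {n} → (Fin n → Fin n → ℤ) → Fin n → Fin n → ℤ
  negate M u v = - M u v

  principalMinor : ∀ {n k} → (Fin n → Fin n → ℤ) → (Fin k → Fin n) → ℤ
  principalMinor M t = detℤ λ r c → M (t r) (t c)

  principalMinor-cong : ∀ {n k} (M : Fin n → Fin n → ℤ) {t u : Fin k → Fin n} → (∀ i → t i ≡ u i) →
                        principalMinor M t ≡ principalMinor M u
  principalMinor-cong M t≗u = detℤ-cong λ r c → cong₂ M (t≗u r) (t≗u c)

  det-zeroRow : ∀ {n} (M : Fin n → Fin n → ℤ) r → (∀ c → M r c ≡ + 0) → detℤ M ≡ + 0
  det-zeroRow {suc n} M zero row≡0 = sum-zero λ j →
    laplaceTerm-entry≡0 (sgn j) (detℤ (minor M zero j)) (row≡0 j)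
  det-zeroRow {suc n} M (suc r) row≡0 = sum-zero λ j →
    laplaceTerm-minor≡0 (sgn j) (M zero j) (det-zeroRow (minor M zero j) r (row≡0 ∘ punchIn j))

  δ : ∀ {n} → Fin n → Fin n → ℤ
  δ i j = if does (i ≟ j) then + 1 else + 0

  δ-refl : ∀ {n} (i : Fin n) → δ i i ≡ + 1
  δ-refl i with i ≟ i
  ... | yes _  = refl
  ... | no i≢i = ⊥-elim (i≢i refl)

  δ-≢ : ∀ {n} {i j : Fin n} → i ≢ j → δ i j ≡ + 0
  δ-≢ {i = i} {j} i≢j with i ≟ j
  ... | yes i≡j = ⊥-elim (i≢j i≡j)
  ... | no _    = refl

  δ-punchIn : ∀ {n} (p : Fin (suc n)) i j → δ (punchIn p i) (punchIn p j) ≡ δ i j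
  δ-punchIn p i j with i ≟ j
  ... | yes refl = δ-refl (punchIn p i)
  ... | no i≢j   = δ-≢ (i≢j ∘ punchIn-injective p i j)

  -- Deleting column c and then column punchIn c j leaves the same columns as deleting
  -- column punchIn c j and then column mate c j; mate c j is the position of c
  -- once column punchIn c j is gone.
  mate : ∀ {n} → Fin (suc (suc n)) → Fin (suc n) → Fin (suc n)
  mate zero    j       = zero
  mate (suc c) zero    = c
  mate {suc n} (suc c) (suc j) = suc (mate c j)

  punchIn-mate : ∀ {n} (c : Fin (suc (suc n))) j → punchIn (punchIn c j) (mate c j) ≡ c
  punchIn-mate zero    j       = refl
  punchIn-mate (suc c) zero    = refl
  punchIn-mate {suc n} (suc c) (suc j) = cong suc (punchIn-mate c j)

  punchIn-punchIn-mate : ∀ {n} (c : Fin (suc (suc n))) j k →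
                         punchIn (punchIn c j) (punchIn (mate c j) k) ≡ punchIn c (punchIn j k)
  punchIn-punchIn-mate zero    j       k       = refl
  punchIn-punchIn-mate (suc c) zero    k       = refl
  punchIn-punchIn-mate {suc n} (suc c) (suc j) zero    = refl
  punchIn-punchIn-mate {suc n} (suc c) (suc j) (suc k) = cong suc (punchIn-punchIn-mate c j k)

  sgn-mate : ∀ {n} (c : Fin (suc (suc n))) j → sgn (punchIn c j) * sgn (mate c j) ≡ - (sgn c * sgn j)
  sgn-mate zero j = begin
    sgn (suc j) * + 1 ≡⟨ cong (_* + 1) (sgn-suc j) ⟩
    - sgn j * + 1     ≡⟨ lemma (sgn j) ⟩
    - (+ 1 * sgn j)   ∎
    where
    lemma : ∀ s → - s * + 1 ≡ - (+ 1 * s)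
    lemma = solve-∀
    open ≡-Reasoning
  sgn-mate (suc c) zero = begin
    + 1 * sgn c           ≡⟨ lemma (sgn c) ⟩
    - (- sgn c * + 1)     ≡⟨ cong (λ s → - (s * + 1)) (sym (sgn-suc c)) ⟩
    - (sgn (suc c) * + 1) ∎
    where
    lemma : ∀ s → + 1 * s ≡ - (- s * + 1)
    lemma = solve-∀
    open ≡-Reasoning
  sgn-mate {suc n} (suc c) (suc j) = begin
    sgn (suc (punchIn c j)) * sgn (suc (mate c j)) ≡⟨ cong₂ _*_ (sgn-suc (punchIn c j)) (sgn-suc (mate c j)) ⟩
    - sgn (punchIn c j) * - sgn (mate c j)         ≡⟨ neg*neg (sgn (punchIn c j)) (sgn (mate c j)) ⟩
    sgn (punchIn c j) * sgn (mate c j)             ≡⟨ sgn-mate c j ⟩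
    - (sgn c * sgn j)                              ≡⟨ cong -_ (sym (neg*neg (sgn c) (sgn j))) ⟩
    - (- sgn c * - sgn j)                          ≡⟨ cong₂ (λ s t → - (s * t)) (sym (sgn-suc c)) (sym (sgn-suc j)) ⟩
    - (sgn (suc c) * sgn (suc j))                  ∎
    where
    neg*neg : ∀ s t → - s * - t ≡ s * t
    neg*neg = solve-∀
    open ≡-Reasoning

  det-unitRow : ∀ {n} (M : Fin (suc n) → Fin (suc n) → ℤ) r c → (∀ j → M r j ≡ δ c j) →
                detℤ M ≡ sgn r * sgn c * detℤ (minor M r c)
  det-unitRow M zero c row = begin
    detℤ M                                 ≡⟨ sum-remove {i = c} term ⟩
    term c + sum (term ∘ punchIn c)        ≡⟨ cong₂ _+_ (cong (λ m → sgn c * (m * D c)) (trans (row c) (δ-refl c)))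
                                                        (sum-zero off-c) ⟩
    sgn c * (+ 1 * D c) + + 0              ≡⟨ lemma (sgn c) (D c) ⟩
    + 1 * sgn c * D c                      ∎
    where
    open ≡-Reasoning
    D : Fin _ → ℤ
    D j = detℤ (minor M zero j)
    term : Fin _ → ℤ
    term j = sgn j * (M zero j * D j)
    off-c : ∀ j → term (punchIn c j) ≡ + 0
    off-c j = laplaceTerm-entry≡0 (sgn (punchIn c j)) (D (punchIn c j))
                (trans (row (punchIn c j)) (δ-≢ (punchInᵢ≢i c j ∘ sym)))
    lemma : ∀ s d → s * (+ 1 * d) + + 0 ≡ + 1 * s * d
    lemma = solve-∀
  det-unitRow {suc n} M (suc r) c row = begin
    detℤ M                                                  ≡⟨ sum-remove {i = c} term ⟩
    term c + sum (term ∘ punchIn c)                         ≡⟨ cong₂ _+_ on-c (sum-cong-≋ off-c) ⟩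
    + 0 + sum (λ j → s * (sgn j * (M zero (punchIn c j) * Y j))) ≡⟨ ℤ.+-identityˡ _ ⟩
    sum (λ j → s * (sgn j * (M zero (punchIn c j) * Y j)))  ≡⟨ sym (*-distribˡ-sum s λ j → sgn j * (M zero (punchIn c j) * Y j)) ⟩
    s * detℤ (minor M (suc r) c)                            ∎
    where
    open ≡-Reasoning
    s : ℤ
    s = sgn (suc r) * sgn c
    term : Fin _ → ℤ
    term j = sgn j * (M zero j * detℤ (minor M zero j))
    Y : Fin (suc n) → ℤ
    Y j = detℤ (minor (minor M (suc r) c) zero j)
    on-c : term c ≡ + 0
    on-c = laplaceTerm-minor≡0 (sgn c) (M zero c)
             (det-zeroRow (minor M zero c) r λ k → trans (row (punchIn c k)) (δ-≢ (punchInᵢ≢i c k ∘ sym)))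
    minor-row : ∀ j k → minor M zero (punchIn c j) r k ≡ δ (mate c j) k
    minor-row j k = begin
      M (suc r) (punchIn (punchIn c j) k)                    ≡⟨ row (punchIn (punchIn c j) k) ⟩
      δ c (punchIn (punchIn c j) k)                          ≡⟨ cong (λ i → δ i (punchIn (punchIn c j) k)) (sym (punchIn-mate c j)) ⟩
      δ (punchIn (punchIn c j) (mate c j)) (punchIn (punchIn c j) k) ≡⟨ δ-punchIn (punchIn c j) (mate c j) k ⟩
      δ (mate c j) k                                          ∎
    minor-det : ∀ j → detℤ (minor M zero (punchIn c j)) ≡ sgn r * sgn (mate c j) * Y j
    minor-det j = trans (det-unitRow (minor M zero (punchIn c j)) r (mate c j) (minor-row j))
                        (cong (sgn r * sgn (mate c j) *_)
                              (detℤ-cong λ i k → cong (M (suc (punchIn r i))) (punchIn-punchIn-mate c j k)))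
    regroup : ∀ p q sr sc sj m y → p * q ≡ - (sc * sj) →
              p * (m * (sr * q * y)) ≡ - sr * sc * (sj * (m * y))
    regroup p q sr sc sj m y pq = begin
      p * (m * (sr * q * y))       ≡⟨ lemma₁ p q sr m y ⟩
      p * q * (sr * m * y)         ≡⟨ cong (λ z → z * (sr * m * y)) pq ⟩
      - (sc * sj) * (sr * m * y)   ≡⟨ lemma₂ sc sj sr m y ⟩
      - sr * sc * (sj * (m * y))   ∎
      where
      lemma₁ : ∀ p q sr m y → p * (m * (sr * q * y)) ≡ p * q * (sr * m * y)
      lemma₁ = solve-∀
      lemma₂ : ∀ sc sj sr m y → - (sc * sj) * (sr * m * y) ≡ - sr * sc * (sj * (m * y))
      lemma₂ = solve-∀
    off-c : ∀ j → term (punchIn c j) ≡ s * (sgn j * (M zero (punchIn c j) * Y j))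
    off-c j = begin
      sgn (punchIn c j) * (M zero (punchIn c j) * detℤ (minor M zero (punchIn c j)))
        ≡⟨ cong (λ d → sgn (punchIn c j) * (M zero (punchIn c j) * d)) (minor-det j) ⟩
      sgn (punchIn c j) * (M zero (punchIn c j) * (sgn r * sgn (mate c j) * Y j))
        ≡⟨ regroup (sgn (punchIn c j)) (sgn (mate c j)) (sgn r) (sgn c) (sgn j) (M zero (punchIn c j)) (Y j) (sgn-mate c j) ⟩
      - sgn r * sgn c * (sgn j * (M zero (punchIn c j) * Y j))
        ≡⟨ cong (λ z → z * sgn c * (sgn j * (M zero (punchIn c j) * Y j))) (sym (sgn-suc r)) ⟩
      s * (sgn j * (M zero (punchIn c j) * Y j)) ∎

  coeff-+ₚ : ∀ p q i → coeff (p +ₚ q) i ≡ coeff p i + coeff q i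
  coeff-+ₚ []      q       i       = sym (ℤ.+-identityˡ (coeff q i))
  coeff-+ₚ (a ∷ p) []      i       = sym (ℤ.+-identityʳ (coeff (a ∷ p) i))
  coeff-+ₚ (a ∷ p) (b ∷ q) zero    = refl
  coeff-+ₚ (a ∷ p) (b ∷ q) (suc i) = coeff-+ₚ p q i

  coeff-scaleₚ : ∀ c p i → coeff (scaleₚ c p) i ≡ c * coeff p i
  coeff-scaleₚ c []      i       = sym (ℤ.*-zeroʳ c)
  coeff-scaleₚ c (a ∷ p) zero    = refl
  coeff-scaleₚ c (a ∷ p) (suc i) = coeff-scaleₚ c p i

  coeff-sign : ∀ {n} (j : Fin n) p i → coeff (sign j p) i ≡ sgn j * coeff p i
  coeff-sign zero          p i = sym (ℤ.*-identityˡ (coeff p i))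
  coeff-sign (suc zero)    p i = coeff-scaleₚ (- + 1) p i
  coeff-sign (suc (suc j)) p i = coeff-sign j p i

  coeff-sumFinₚ : ∀ {n} (f : Fin n → Poly) i → coeff (sumFinₚ f) i ≡ sum λ j → coeff (f j) i
  coeff-sumFinₚ {zero}  f i = refl
  coeff-sumFinₚ {suc n} f i = trans (coeff-+ₚ (f zero) (sumFinₚ (f ∘ suc)) i)
                                    (cong (λ s → coeff (f zero) i + s) (coeff-sumFinₚ (f ∘ suc) i))

  coeff-*ₚ-zero : ∀ p q → coeff (p *ₚ q) 0 ≡ coeff p 0 * coeff q 0
  coeff-*ₚ-zero []      q = refl
  coeff-*ₚ-zero (a ∷ p) q = trans (coeff-+ₚ (scaleₚ a q) (+ 0 ∷ p *ₚ q) 0)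
                                  (trans (ℤ.+-identityʳ (coeff (scaleₚ a q) 0)) (coeff-scaleₚ a q 0))

  coeff-*ₚ-constant : ∀ p q i → (∀ j → coeff p (suc j) ≡ + 0) → coeff (p *ₚ q) i ≡ coeff p 0 * coeff q i
  coeff-*ₚ-constant []      q i       p≡c = refl
  coeff-*ₚ-constant (a ∷ p) q i       p≡c = begin
    coeff (scaleₚ a q +ₚ (+ 0 ∷ p *ₚ q)) i       ≡⟨ coeff-+ₚ (scaleₚ a q) (+ 0 ∷ p *ₚ q) i ⟩
    coeff (scaleₚ a q) i + coeff (+ 0 ∷ p *ₚ q) i ≡⟨ cong₂ _+_ (coeff-scaleₚ a q i) (shifted-zero i) ⟩
    a * coeff q i + + 0                           ≡⟨ ℤ.+-identityʳ (a * coeff q i) ⟩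
    a * coeff q i                                 ∎
    where
    open ≡-Reasoning
    shifted-zero : ∀ i → coeff (+ 0 ∷ p *ₚ q) i ≡ + 0
    shifted-zero zero    = refl
    shifted-zero (suc i) = trans (coeff-*ₚ-constant p q i (p≡c ∘ suc)) (cong (_* coeff q i) (p≡c zero))

  coeff-*ₚ-linear : ∀ p q i → (∀ j → coeff p (2 ℕ.+ j) ≡ + 0) →
                    coeff (p *ₚ q) (suc i) ≡ coeff p 0 * coeff q (suc i) + coeff p 1 * coeff q i
  coeff-*ₚ-linear []      q i p≡l = refl
  coeff-*ₚ-linear (a ∷ p) q i p≡l =
    trans (coeff-+ₚ (scaleₚ a q) (+ 0 ∷ p *ₚ q) (suc i))
          (cong₂ _+_ (coeff-scaleₚ a q (suc i)) (coeff-*ₚ-constant p q i p≡l))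

  record IsPencil {n} (P : Fin n → Fin n → Poly) (E A : Fin n → Fin n → ℤ) : Set where
    field
      coeff₀  : ∀ u v → coeff (P u v) 0 ≡ - A u v
      coeff₁  : ∀ u v → coeff (P u v) 1 ≡ E u v
      coeff₂₊ : ∀ u v i → coeff (P u v) (2 ℕ.+ i) ≡ + 0

  module _ {n} {P : Fin (suc n) → Fin (suc n) → Poly} {E A : Fin (suc n) → Fin (suc n) → ℤ} (pencil : IsPencil P E A) where
    open IsPencil pencil

    minor-isPencil : ∀ r c → IsPencil (minor P r c) (minor E r c) (minor A r c)
    minor-isPencil r c = record
      { coeff₀ = λ u v → coeff₀ (punchIn r u) (punchIn c v)
      ; coeff₁ = λ u v → coeff₁ (punchIn r u) (punchIn c v)
      ; coeff₂₊ = λ u v → coeff₂₊ (punchIn r u) (punchIn c v)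
      }

    coeff-det-zero : coeff (det P) 0 ≡ sum λ j → sgn j * (- A zero j * coeff (det (minor P zero j)) 0)
    coeff-det-zero = trans (coeff-sumFinₚ (λ j → sign j (P zero j *ₚ det (minor P zero j))) 0) (sum-cong-≋ λ j → begin
      coeff (sign j (P zero j *ₚ det (minor P zero j))) 0  ≡⟨ coeff-sign j (P zero j *ₚ det (minor P zero j)) 0 ⟩
      sgn j * coeff (P zero j *ₚ det (minor P zero j)) 0   ≡⟨ cong (sgn j *_) (coeff-*ₚ-zero (P zero j) (det (minor P zero j))) ⟩
      sgn j * (coeff (P zero j) 0 * coeff (det (minor P zero j)) 0)
                                                            ≡⟨ cong (λ a → sgn j * (a * coeff (det (minor P zero j)) 0)) (coeff₀ zero j) ⟩
      sgn j * (- A zero j * coeff (det (minor P zero j)) 0) ∎)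
      where open ≡-Reasoning

    coeff-det-suc : ∀ i → coeff (det P) (suc i) ≡ sum λ j →
      sgn j * (- A zero j * coeff (det (minor P zero j)) (suc i) + E zero j * coeff (det (minor P zero j)) i)
    coeff-det-suc i = trans (coeff-sumFinₚ (λ j → sign j (P zero j *ₚ det (minor P zero j))) (suc i)) (sum-cong-≋ λ j → begin
      coeff (sign j (P zero j *ₚ det (minor P zero j))) (suc i) ≡⟨ coeff-sign j (P zero j *ₚ det (minor P zero j)) (suc i) ⟩
      sgn j * coeff (P zero j *ₚ det (minor P zero j)) (suc i)  ≡⟨ cong (sgn j *_) (coeff-*ₚ-linear (P zero j) (det (minor P zero j)) i (coeff₂₊ zero j)) ⟩
      sgn j * (coeff (P zero j) 0 * coeff (det (minor P zero j)) (suc i) + coeff (P zero j) 1 * coeff (det (minor P zero j)) i)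
        ≡⟨ cong₂ (λ a b → sgn j * (a * coeff (det (minor P zero j)) (suc i) + b * coeff (det (minor P zero j)) i))
                 (coeff₀ zero j) (coeff₁ zero j) ⟩
      sgn j * (- A zero j * coeff (det (minor P zero j)) (suc i) + E zero j * coeff (det (minor P zero j)) i) ∎)
      where open ≡-Reasoning

  det-degree : ∀ {n} {P E A} → IsPencil {n} P E A → ∀ m → n ≤ m → coeff (det P) (suc m) ≡ + 0
  det-degree {zero}  pencil m n≤m = refl
  det-degree {suc n} {P} {E} {A} pencil (suc m) (s≤s n≤m) =
    trans (coeff-det-suc pencil (suc m)) (sum-zero λ j →
      trans (cong₂ (λ d d′ → sgn j * (- A zero j * d + E zero j * d′))
                   (det-degree (minor-isPencil pencil zero j) (suc m) (ℕ.m≤n⇒m≤1+n n≤m))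
                   (det-degree (minor-isPencil pencil zero j) m n≤m))
            (lemma (sgn j) (- A zero j) (E zero j)))
    where
    lemma : ∀ s a e → s * (a * + 0 + e * + 0) ≡ + 0
    lemma = solve-∀

  -- A choice of k of the indices 0 … n-1, leaving out the other m.
  data Choose : ℕ → ℕ → ℕ → Set where
    []   : Choose 0 0 0
    take : ∀ {n m k} → Choose n m k → Choose (suc n) m (suc k)
    skip : ∀ {n m k} → Choose n m k → Choose (suc n) (suc m) k

  ∑Choose : ∀ n m k → (Choose n m k → ℤ) → ℤ
  ∑Choose zero    zero    zero    F = F []
  ∑Choose zero    zero    (suc k) F = + 0
  ∑Choose zero    (suc m) k       F = + 0
  ∑Choose (suc n) zero    zero    F = + 0
  ∑Choose (suc n) zero    (suc k) F = ∑Choose n zero k (F ∘ take)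
  ∑Choose (suc n) (suc m) zero    F = ∑Choose n m zero (F ∘ skip)
  ∑Choose (suc n) (suc m) (suc k) F = ∑Choose n (suc m) k (F ∘ take) + ∑Choose n m (suc k) (F ∘ skip)

  ∑Choose-cong : ∀ n m k {F G : Choose n m k → ℤ} → (∀ T → F T ≡ G T) → ∑Choose n m k F ≡ ∑Choose n m k G
  ∑Choose-cong zero    zero    zero    F≡G = F≡G []
  ∑Choose-cong zero    zero    (suc k) F≡G = refl
  ∑Choose-cong zero    (suc m) k       F≡G = refl
  ∑Choose-cong (suc n) zero    zero    F≡G = refl
  ∑Choose-cong (suc n) zero    (suc k) F≡G = ∑Choose-cong n zero k (F≡G ∘ take)
  ∑Choose-cong (suc n) (suc m) zero    F≡G = ∑Choose-cong n m zero (F≡G ∘ skip)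
  ∑Choose-cong (suc n) (suc m) (suc k) F≡G =
    cong₂ _+_ (∑Choose-cong n (suc m) k (F≡G ∘ take)) (∑Choose-cong n m (suc k) (F≡G ∘ skip))

  ∑Choose-+ : ∀ n m k (F G : Choose n m k → ℤ) →
              ∑Choose n m k (λ T → F T + G T) ≡ ∑Choose n m k F + ∑Choose n m k G
  ∑Choose-+ zero    zero    zero    F G = refl
  ∑Choose-+ zero    zero    (suc k) F G = refl
  ∑Choose-+ zero    (suc m) k       F G = refl
  ∑Choose-+ (suc n) zero    zero    F G = refl
  ∑Choose-+ (suc n) zero    (suc k) F G = ∑Choose-+ n zero k (F ∘ take) (G ∘ take)
  ∑Choose-+ (suc n) (suc m) zero    F G = ∑Choose-+ n m zero (F ∘ skip) (G ∘ skip)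
  ∑Choose-+ (suc n) (suc m) (suc k) F G = begin
    ∑Choose n (suc m) k (λ T → F (take T) + G (take T)) + ∑Choose n m (suc k) (λ T → F (skip T) + G (skip T))
      ≡⟨ cong₂ _+_ (∑Choose-+ n (suc m) k (F ∘ take) (G ∘ take)) (∑Choose-+ n m (suc k) (F ∘ skip) (G ∘ skip)) ⟩
    (Ft + Gt) + (Fs + Gs) ≡⟨ lemma Ft Gt Fs Gs ⟩
    (Ft + Fs) + (Gt + Gs) ∎
    where
    open ≡-Reasoning
    Ft = ∑Choose n (suc m) k (F ∘ take)
    Gt = ∑Choose n (suc m) k (G ∘ take)
    Fs = ∑Choose n m (suc k) (F ∘ skip)
    Gs = ∑Choose n m (suc k) (G ∘ skip)
    lemma : ∀ a b c d → (a + b) + (c + d) ≡ (a + c) + (b + d)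
    lemma = solve-∀

  ∑Choose-*ˡ : ∀ n m k c (F : Choose n m k → ℤ) → ∑Choose n m k (λ T → c * F T) ≡ c * ∑Choose n m k F
  ∑Choose-*ˡ zero    zero    zero    c F = refl
  ∑Choose-*ˡ zero    zero    (suc k) c F = sym (ℤ.*-zeroʳ c)
  ∑Choose-*ˡ zero    (suc m) k       c F = sym (ℤ.*-zeroʳ c)
  ∑Choose-*ˡ (suc n) zero    zero    c F = sym (ℤ.*-zeroʳ c)
  ∑Choose-*ˡ (suc n) zero    (suc k) c F = ∑Choose-*ˡ n zero k c (F ∘ take)
  ∑Choose-*ˡ (suc n) (suc m) zero    c F = ∑Choose-*ˡ n m zero c (F ∘ skip)
  ∑Choose-*ˡ (suc n) (suc m) (suc k) c F =
    trans (cong₂ _+_ (∑Choose-*ˡ n (suc m) k c (F ∘ take)) (∑Choose-*ˡ n m (suc k) c (F ∘ skip)))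
          (sym (ℤ.*-distribˡ-+ c (∑Choose n (suc m) k (F ∘ take)) (∑Choose n m (suc k) (F ∘ skip))))

  ∑Choose-zero : ∀ n m k → ∑Choose n m k (λ _ → + 0) ≡ + 0
  ∑Choose-zero n m k = trans (∑Choose-*ˡ n m k (+ 0) (λ _ → + 0)) (ℤ.*-zeroˡ (∑Choose n m k (λ _ → + 0)))

  ∑Choose-sum-comm : ∀ n m k {l} (F : Fin l → Choose n m k → ℤ) →
                     ∑Choose n m k (λ T → sum λ j → F j T) ≡ sum λ j → ∑Choose n m k (F j)
  ∑Choose-sum-comm n m k {zero}  F = ∑Choose-zero n m k
  ∑Choose-sum-comm n m k {suc l} F =
    trans (∑Choose-+ n m k (F zero) (λ T → sum λ j → F (suc j) T))
          (cong (λ s → ∑Choose n m k (F zero) + s) (∑Choose-sum-comm n m k (F ∘ suc)))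

  isSkipped : ∀ {n m k} → Choose n m k → Fin n → Bool
  isSkipped (take T) zero    = false
  isSkipped (take T) (suc r) = isSkipped T r
  isSkipped (skip T) zero    = true
  isSkipped (skip T) (suc r) = isSkipped T r

  mix : ∀ {n m k} → (E A : Fin n → Fin n → ℤ) → Choose n m k → Fin n → Fin n → ℤ
  mix E A T r c = if isSkipped T r then E r c else - A r c

  -- By multilinearity in the rows, the coefficient of λ^m collects the ways of letting m rows contribute λE.
  coeff-det-pencil : ∀ n {P E A} → IsPencil {n} P E A → ∀ m k → m ℕ.+ k ≡ n →
                     coeff (det P) m ≡ ∑Choose n m k (detℤ ∘ mix E A)
  coeff-det-pencil zero    pencil zero zero refl = refl
  coeff-det-pencil (suc n) {P} {E} {A} pencil = expand
    where
    open ≡-Reasoning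
    M : Fin (suc n) → Fin n → Fin n → Poly
    M = minor P zero
    G : ∀ {m k} → Fin (suc n) → Choose n m k → ℤ
    G j = detℤ ∘ mix (minor E zero j) (minor A zero j)
    IH : ∀ j m k → m ℕ.+ k ≡ n → coeff (det (M j)) m ≡ ∑Choose n m k (G j)
    IH j = coeff-det-pencil n (minor-isPencil pencil zero j)
    gather : ∀ {m k} (a : Fin (suc n) → ℤ) →
             sum (λ j → sgn j * (a j * ∑Choose n m k (G j))) ≡ ∑Choose n m k (λ T → sum λ j → sgn j * (a j * G j T))
    gather {m} {k} a = sym (trans (∑Choose-sum-comm n m k λ j T → sgn j * (a j * G j T)) (sum-cong-≋ λ j →
      trans (∑Choose-*ˡ n m k (sgn j) (λ T → a j * G j T)) (cong (sgn j *_) (∑Choose-*ˡ n m k (a j) (G j)))))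
    expand : ∀ m k → m ℕ.+ k ≡ suc n → coeff (det P) m ≡ ∑Choose (suc n) m k (detℤ ∘ mix E A)
    expand zero (suc k) refl = begin
      coeff (det P) 0                                            ≡⟨ coeff-det-zero pencil ⟩
      sum (λ j → sgn j * (- A zero j * coeff (det (M j)) 0))     ≡⟨ sum-cong-≋ (λ j → cong (λ d → sgn j * (- A zero j * d)) (IH j 0 k refl)) ⟩
      sum (λ j → sgn j * (- A zero j * ∑Choose n 0 k (G j)))     ≡⟨ gather (λ j → - A zero j) ⟩
      ∑Choose n 0 k (detℤ ∘ mix E A ∘ take)                      ∎
    expand (suc m) zero refl = begin
      coeff (det P) (suc m)
        ≡⟨ coeff-det-suc pencil m ⟩
      sum (λ j → sgn j * (- A zero j * coeff (det (M j)) (suc m) + E zero j * coeff (det (M j)) m))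
        ≡⟨ sum-cong-≋ (λ j → cong₂ (λ d d′ → sgn j * (- A zero j * d + E zero j * d′))
                                   (det-degree (minor-isPencil pencil zero j) m (ℕ.≤-reflexive (ℕ.+-identityʳ m)))
                                   (IH j m 0 refl)) ⟩
      sum (λ j → sgn j * (- A zero j * + 0 + E zero j * ∑Choose n m 0 (G j)))
        ≡⟨ sum-cong-≋ (λ j → cong (sgn j *_) (lemma (- A zero j) (E zero j * ∑Choose n m 0 (G j)))) ⟩
      sum (λ j → sgn j * (E zero j * ∑Choose n m 0 (G j)))
        ≡⟨ gather (E zero) ⟩
      ∑Choose n m 0 (detℤ ∘ mix E A ∘ skip) ∎
      where
      lemma : ∀ a b → a * + 0 + b ≡ b
      lemma = solve-∀
    expand (suc m) (suc k) eq = begin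
      coeff (det P) (suc m)
        ≡⟨ coeff-det-suc pencil m ⟩
      sum (λ j → sgn j * (- A zero j * coeff (det (M j)) (suc m) + E zero j * coeff (det (M j)) m))
        ≡⟨ sum-cong-≋ (λ j → cong₂ (λ d d′ → sgn j * (- A zero j * d + E zero j * d′))
                                   (IH j (suc m) k (trans (sym (ℕ.+-suc m k)) m+1+k≡n)) (IH j m (suc k) m+1+k≡n)) ⟩
      sum (λ j → sgn j * (- A zero j * ∑Choose n (suc m) k (G j) + E zero j * ∑Choose n m (suc k) (G j)))
        ≡⟨ sum-cong-≋ (λ j → ℤ.*-distribˡ-+ (sgn j) (- A zero j * ∑Choose n (suc m) k (G j)) (E zero j * ∑Choose n m (suc k) (G j))) ⟩
      sum (λ j → sgn j * (- A zero j * ∑Choose n (suc m) k (G j)) + sgn j * (E zero j * ∑Choose n m (suc k) (G j)))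
        ≡⟨ ∑-distrib-+ (λ j → sgn j * (- A zero j * ∑Choose n (suc m) k (G j))) (λ j → sgn j * (E zero j * ∑Choose n m (suc k) (G j))) ⟩
      sum (λ j → sgn j * (- A zero j * ∑Choose n (suc m) k (G j))) + sum (λ j → sgn j * (E zero j * ∑Choose n m (suc k) (G j)))
        ≡⟨ cong₂ _+_ (gather (λ j → - A zero j)) (gather (E zero)) ⟩
      ∑Choose n (suc m) k (detℤ ∘ mix E A ∘ take) + ∑Choose n m (suc k) (detℤ ∘ mix E A ∘ skip) ∎
      where
      m+1+k≡n : m ℕ.+ suc k ≡ n
      m+1+k≡n = ℕ.suc-injective eq

  prependZero : ∀ {k n} → (Fin k → Fin n) → Fin (suc k) → Fin (suc n)
  prependZero t = zero Vector.∷ suc ∘ t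

  chosen : ∀ {n m k} → Choose n m k → Fin k → Fin n
  chosen []       = λ ()
  chosen (take T) = prependZero (chosen T)
  chosen (skip T) = suc ∘ chosen T

  record SkippedRow {n m k} (T : Choose (suc n) (suc m) k) : Set where
    field
      row               : Fin (suc n)
      rest              : Choose n m k
      row-skipped       : isSkipped T row ≡ true
      isSkipped-punchIn : ∀ r → isSkipped T (punchIn row r) ≡ isSkipped rest r
      chosen-punchIn    : ∀ i → chosen T i ≡ punchIn row (chosen rest i)

  firstSkipped : ∀ {n m k} (T : Choose (suc n) (suc m) k) → SkippedRow T
  firstSkipped (skip T) = record
    { row = zero ; rest = T ; row-skipped = refl ; isSkipped-punchIn = λ r → refl ; chosen-punchIn = λ i → refl }
  firstSkipped {zero}  (take ())
  firstSkipped {suc n} (take T) = record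
    { row = suc row ; rest = take rest ; row-skipped = row-skipped
    ; isSkipped-punchIn = isSkipped-punchIn′ ; chosen-punchIn = chosen-punchIn′ }
    where
    open SkippedRow (firstSkipped T)
    isSkipped-punchIn′ : ∀ r → isSkipped (take T) (punchIn (suc row) r) ≡ isSkipped (take rest) r
    isSkipped-punchIn′ zero    = refl
    isSkipped-punchIn′ (suc r) = isSkipped-punchIn r
    chosen-punchIn′ : ∀ i → chosen (take T) i ≡ punchIn (suc row) (chosen (take rest) i)
    chosen-punchIn′ zero    = refl
    chosen-punchIn′ (suc i) = cong suc (chosen-punchIn i)

  choose-all : ∀ {n k} → Choose n 0 k → n ≡ k
  choose-all []       = refl
  choose-all (take T) = cong suc (choose-all T)

  chosen-all : ∀ {n} (T : Choose n 0 n) i → chosen T i ≡ i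
  chosen-all (take T) zero    = refl
  chosen-all (take T) (suc i) = cong suc (chosen-all T i)

  isSkipped-all : ∀ {n k} (T : Choose n 0 k) r → isSkipped T r ≡ false
  isSkipped-all (take T) zero    = refl
  isSkipped-all (take T) (suc r) = isSkipped-all T r

  -- Expanding along the skipped rows, which are rows of the identity, leaves the principal minor.
  det-mix-identity : ∀ n {m k} (T : Choose n m k) (E A : Fin n → Fin n → ℤ) → (∀ r c → E r c ≡ δ r c) →
                     detℤ (mix E A T) ≡ principalMinor (negate A) (chosen T)
  det-mix-identity n {zero} T E A E≡δ with choose-all T
  ... | refl = detℤ-cong λ r c → begin
    mix E A T r c                         ≡⟨ cong (λ b → if b then E r c else - A r c) (isSkipped-all T r) ⟩
    - A r c                               ≡⟨ sym (cong₂ (λ i j → - A i j) (chosen-all T r) (chosen-all T c)) ⟩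
    - A (chosen T r) (chosen T c)         ∎
    where open ≡-Reasoning
  det-mix-identity (suc n) {suc m} T E A E≡δ = begin
    detℤ (mix E A T)                                       ≡⟨ det-unitRow (mix E A T) row row unit-row ⟩
    sgn row * sgn row * detℤ (minor (mix E A T) row row)   ≡⟨ cong (_* detℤ (minor (mix E A T) row row)) (sgn*sgn row) ⟩
    + 1 * detℤ (minor (mix E A T) row row)                 ≡⟨ ℤ.*-identityˡ _ ⟩
    detℤ (minor (mix E A T) row row)                       ≡⟨ detℤ-cong (λ i j → cong (λ b → if b then minor E row row i j else - minor A row row i j)
                                                                                  (isSkipped-punchIn i)) ⟩
    detℤ (mix (minor E row row) (minor A row row) rest)    ≡⟨ det-mix-identity n rest (minor E row row) (minor A row row)
                                                                (λ i j → trans (E≡δ _ _) (δ-punchIn row i j)) ⟩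
    detℤ (λ i j → - A (punchIn row (chosen rest i)) (punchIn row (chosen rest j)))
                                                           ≡⟨ sym (detℤ-cong λ i j → cong₂ (negate A) (chosen-punchIn i) (chosen-punchIn j)) ⟩
    principalMinor (negate A) (chosen T)            ∎
    where
    open ≡-Reasoning
    open SkippedRow (firstSkipped T)
    unit-row : ∀ c → mix E A T row c ≡ δ row c
    unit-row c = trans (cong (λ b → if b then E row c else - A row c) row-skipped) (E≡δ row c)

  ∑Increasing : ∀ n k → ((Fin k → Fin n) → ℤ) → ℤ
  ∑Increasing n       zero    F = F (λ ())
  ∑Increasing zero    (suc k) F = + 0
  ∑Increasing (suc n) (suc k) F = ∑Increasing n k (λ t → F (prependZero t)) + ∑Increasing n (suc k) (λ t → F (suc ∘ t))

  ∑Increasing-cong : ∀ n k {F G : (Fin k → Fin n) → ℤ} → (∀ t → F t ≡ G t) → ∑Increasing n k F ≡ ∑Increasing n k G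
  ∑Increasing-cong n       zero    F≡G = F≡G (λ ())
  ∑Increasing-cong zero    (suc k) F≡G = refl
  ∑Increasing-cong (suc n) (suc k) F≡G =
    cong₂ _+_ (∑Increasing-cong n k λ t → F≡G (prependZero t)) (∑Increasing-cong n (suc k) λ t → F≡G (suc ∘ t))

  ∑Increasing-tooLong : ∀ n k F → n ℕ.< k → ∑Increasing n k F ≡ + 0
  ∑Increasing-tooLong zero    (suc k) F _ = refl
  ∑Increasing-tooLong (suc n) (suc k) F (s≤s n<k) =
    cong₂ _+_ (∑Increasing-tooLong n k _ n<k) (∑Increasing-tooLong n (suc k) _ (ℕ.m≤n⇒m≤1+n n<k))

  ∑Increasing-one : ∀ n (g : Fin n → ℤ) → ∑Increasing n 1 (λ t → g (t 0F)) ≡ sum g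
  ∑Increasing-one zero    g = refl
  ∑Increasing-one (suc n) g = cong (λ s → g zero + s) (∑Increasing-one n (g ∘ suc))

  prependZero-cong : ∀ {n k} {t u : Fin k → Fin n} → (∀ i → t i ≡ u i) → ∀ i → prependZero t i ≡ prependZero u i
  prependZero-cong t≗u zero    = refl
  prependZero-cong t≗u (suc i) = cong suc (t≗u i)

  ∑Choose-chosen : ∀ n m k (F : (Fin k → Fin n) → ℤ) → (∀ {t u} → (∀ i → t i ≡ u i) → F t ≡ F u) →
                   m ℕ.+ k ≡ n → ∑Choose n m k (F ∘ chosen) ≡ ∑Increasing n k F
  ∑Choose-chosen zero    zero    zero    F F-ext eq = F-ext (λ ())
  ∑Choose-chosen zero    zero    (suc k) F F-ext eq = refl
  ∑Choose-chosen (suc n) zero    (suc k) F F-ext eq = begin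
    ∑Choose n 0 k (F ∘ chosen ∘ take)                    ≡⟨ ∑Choose-chosen n 0 k _ (λ t≗u → F-ext (prependZero-cong t≗u)) (ℕ.suc-injective eq) ⟩
    ∑Increasing n k (λ t → F (prependZero t))     ≡⟨ sym (ℤ.+-identityʳ _) ⟩
    ∑Increasing n k (λ t → F (prependZero t)) + + 0
      ≡⟨ cong (λ s → ∑Increasing n k (λ t → F (prependZero t)) + s)
              (sym (∑Increasing-tooLong n (suc k) _ (ℕ.≤-reflexive (sym eq)))) ⟩
    ∑Increasing (suc n) (suc k) F                        ∎
    where open ≡-Reasoning
  ∑Choose-chosen (suc n) (suc m) zero    F F-ext eq =
    trans (∑Choose-chosen n m zero (λ t → F (suc ∘ t)) (λ t≗u → F-ext (cong suc ∘ t≗u)) (ℕ.suc-injective eq))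
          (F-ext (λ ()))
  ∑Choose-chosen (suc n) (suc m) (suc k) F F-ext eq =
    cong₂ _+_ (∑Choose-chosen n (suc m) k _ (λ t≗u → F-ext (prependZero-cong t≗u)) (trans (sym (ℕ.+-suc m k)) (ℕ.suc-injective eq)))
              (∑Choose-chosen n m (suc k) _ (λ t≗u → F-ext (cong suc ∘ t≗u)) (ℕ.suc-injective eq))

  ∑² : ∀ {n} → (Fin n → Fin n → ℤ) → ℤ
  ∑² f = sum λ a → sum (f a)

  ∑³ : ∀ {n} → (Fin n → Fin n → Fin n → ℤ) → ℤ
  ∑³ f = sum λ a → ∑² (f a)

  ∑⁴ : ∀ {n} → (Fin n → Fin n → Fin n → Fin n → ℤ) → ℤ
  ∑⁴ f = sum λ a → ∑³ (f a)

  ∑<² : ∀ n → (Fin n → Fin n → ℤ) → ℤ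
  ∑<² n f = ∑Increasing n 2 λ t → f (t 0F) (t 1F)

  ∑<³ : ∀ n → (Fin n → Fin n → Fin n → ℤ) → ℤ
  ∑<³ n f = ∑Increasing n 3 λ t → f (t 0F) (t 1F) (t 2F)

  ∑<⁴ : ∀ n → (Fin n → Fin n → Fin n → Fin n → ℤ) → ℤ
  ∑<⁴ n f = ∑Increasing n 4 λ t → f (t 0F) (t 1F) (t 2F) (t 3F)

  ∑²-cong : ∀ {n} {f g : Fin n → Fin n → ℤ} → (∀ a b → f a b ≡ g a b) → ∑² f ≡ ∑² g
  ∑²-cong f≡g = sum-cong-≋ λ a → sum-cong-≋ (f≡g a)

  ∑³-cong : ∀ {n} {f g : Fin n → Fin n → Fin n → ℤ} → (∀ a b c → f a b c ≡ g a b c) → ∑³ f ≡ ∑³ g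
  ∑³-cong f≡g = sum-cong-≋ λ a → ∑²-cong (f≡g a)

  ∑⁴-cong : ∀ {n} {f g : Fin n → Fin n → Fin n → Fin n → ℤ} → (∀ a b c d → f a b c d ≡ g a b c d) → ∑⁴ f ≡ ∑⁴ g
  ∑⁴-cong f≡g = sum-cong-≋ λ a → ∑³-cong (f≡g a)

  ∑²-zero : ∀ {n} {f : Fin n → Fin n → ℤ} → (∀ a b → f a b ≡ + 0) → ∑² f ≡ + 0
  ∑²-zero f≡0 = sum-zero λ a → sum-zero (f≡0 a)

  ∑-distrib-+₄ : ∀ {n} (f g h k : Fin n → ℤ) →
                 sum (λ a → (f a + g a) + (h a + k a)) ≡ (sum f + sum g) + (sum h + sum k)
  ∑-distrib-+₄ f g h k = trans (∑-distrib-+ (λ a → f a + g a) (λ a → h a + k a))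
                               (cong₂ _+_ (∑-distrib-+ f g) (∑-distrib-+ h k))

  ∑²-split : ∀ {n} (f : Fin (suc n) → Fin (suc n) → ℤ) →
             ∑² f ≡ (f zero zero + sum (λ b → f zero (suc b))) + (sum (λ a → f (suc a) zero) + ∑² (λ a b → f (suc a) (suc b)))
  ∑²-split f = cong (λ s → (f zero zero + sum (λ b → f zero (suc b))) + s)
                    (∑-distrib-+ (λ a → f (suc a) zero) (λ a → sum λ b → f (suc a) (suc b)))

  ∑³-split : ∀ {n} (f : Fin (suc n) → Fin (suc n) → Fin (suc n) → ℤ) →
    ∑³ f ≡ ((f zero zero zero + sum (λ c → f zero zero (suc c))) + (sum (λ b → f zero (suc b) zero) + ∑² (λ b c → f zero (suc b) (suc c))))
         + ((sum (λ a → f (suc a) zero zero) + ∑² (λ a c → f (suc a) zero (suc c)))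
            + (∑² (λ a b → f (suc a) (suc b) zero) + ∑³ (λ a b c → f (suc a) (suc b) (suc c))))
  ∑³-split f = cong₂ _+_ (∑²-split (f zero))
    (trans (sum-cong-≋ λ a → ∑²-split (f (suc a)))
           (∑-distrib-+₄ (λ a → f (suc a) zero zero) (λ a → sum λ c → f (suc a) zero (suc c))
                         (λ a → sum λ b → f (suc a) (suc b) zero) (λ a → ∑² λ b c → f (suc a) (suc b) (suc c))))

  ∑²-symmetric : ∀ n (f : Fin n → Fin n → ℤ) → (∀ a b → f a b ≡ f b a) → (∀ a → f a a ≡ + 0) →
                 ∑² f ≡ + 2 * ∑<² n f
  ∑²-symmetric zero    f swap diag = refl
  ∑²-symmetric (suc n) f swap diag = begin
    ∑² f                                    ≡⟨ ∑²-split f ⟩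
    (f zero zero + X) + (sum (λ a → f (suc a) zero) + ∑² (λ a b → f (suc a) (suc b)))
      ≡⟨ cong₂ (λ d s → (d + X) + s) (diag zero)
               (cong₂ _+_ (sum-cong-≋ λ a → swap (suc a) zero) (∑²-symmetric n (λ a b → f (suc a) (suc b)) (λ a b → swap _ _) (diag ∘ suc))) ⟩
    (+ 0 + X) + (X + + 2 * Y)               ≡⟨ lemma X Y ⟩
    + 2 * (X + Y)                           ≡⟨ cong (λ s → + 2 * (s + Y)) (sym (∑Increasing-one n (f zero ∘ suc))) ⟩
    + 2 * ∑<² (suc n) f                     ∎
    where
    open ≡-Reasoning
    X = sum λ b → f zero (suc b)
    Y = ∑<² n λ a b → f (suc a) (suc b)
    lemma : ∀ x y → (+ 0 + x) + (x + + 2 * y) ≡ + 2 * (x + y)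
    lemma = solve-∀

  record Symmetric₃ {n} (f : Fin n → Fin n → Fin n → ℤ) : Set where
    field
      swap₁₂ : ∀ a b c → f a b c ≡ f b a c
      swap₂₃ : ∀ a b c → f a b c ≡ f a c b
      diag₁₂ : ∀ a c → f a a c ≡ + 0
      diag₁₃ : ∀ a b → f a b a ≡ + 0
      diag₂₃ : ∀ a b → f a b b ≡ + 0

  ∑³-symmetric : ∀ n (f : Fin n → Fin n → Fin n → ℤ) → Symmetric₃ f → ∑³ f ≡ + 6 * ∑<³ n f
  ∑³-symmetric zero    f sym = refl
  ∑³-symmetric (suc n) f sym = begin
    ∑³ f
      ≡⟨ ∑³-split f ⟩
    ((f zero zero zero + sum (λ c → f zero zero (suc c))) + (sum (λ b → f zero (suc b) zero) + ∑² g))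
    + ((sum (λ a → f (suc a) zero zero) + ∑² (λ a c → f (suc a) zero (suc c)))
       + (∑² (λ a b → f (suc a) (suc b) zero) + ∑³ f↑))
      ≡⟨ cong₂ _+_ (cong₂ _+_ (cong₂ _+_ (diag₁₂ zero zero) (sum-zero (diag₁₂ zero ∘ suc)))
                              (cong₂ _+_ (sum-zero λ b → diag₁₃ zero (suc b)) ∑²g))
                   (cong₂ _+_ (cong₂ _+_ (sum-zero λ a → diag₂₃ (suc a) zero)
                                         (trans (∑²-cong λ a c → swap₁₂ (suc a) zero (suc c)) ∑²g))
                              (cong₂ _+_ (trans (∑²-cong λ a b → trans (swap₂₃ (suc a) (suc b) zero) (swap₁₂ (suc a) zero (suc b))) ∑²g)
                                         (∑³-symmetric n f↑ sym↑))) ⟩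
    ((+ 0 + + 0) + (+ 0 + + 2 * Q)) + ((+ 0 + + 2 * Q) + (+ 2 * Q + + 6 * R))
      ≡⟨ lemma Q R ⟩
    + 6 * (Q + R) ∎
    where
    open ≡-Reasoning
    open Symmetric₃ sym
    g : Fin n → Fin n → ℤ
    g b c = f zero (suc b) (suc c)
    f↑ : Fin n → Fin n → Fin n → ℤ
    f↑ a b c = f (suc a) (suc b) (suc c)
    sym↑ : Symmetric₃ f↑
    sym↑ = record { swap₁₂ = λ a b c → swap₁₂ _ _ _ ; swap₂₃ = λ a b c → swap₂₃ _ _ _
                  ; diag₁₂ = λ a c → diag₁₂ _ _ ; diag₁₃ = λ a b → diag₁₃ _ _ ; diag₂₃ = λ a b → diag₂₃ _ _ }
    Q = ∑<² n g
    R = ∑<³ n f↑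
    ∑²g : ∑² g ≡ + 2 * Q
    ∑²g = ∑²-symmetric n g (λ b c → swap₂₃ zero (suc b) (suc c)) (λ b → diag₂₃ zero (suc b))
    lemma : ∀ q r → ((+ 0 + + 0) + (+ 0 + + 2 * q)) + ((+ 0 + + 2 * q) + (+ 2 * q + + 6 * r)) ≡ + 6 * (q + r)
    lemma = solve-∀

  ∑⁴-split : ∀ {n} (f : Fin (suc n) → Fin (suc n) → Fin (suc n) → Fin (suc n) → ℤ) →
    ∑⁴ f ≡ (((f zero zero zero zero + sum (λ d → f zero zero zero (suc d)))
             + (sum (λ c → f zero zero (suc c) zero) + ∑² (λ c d → f zero zero (suc c) (suc d))))
            + ((sum (λ b → f zero (suc b) zero zero) + ∑² (λ b d → f zero (suc b) zero (suc d)))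
               + (∑² (λ b c → f zero (suc b) (suc c) zero) + ∑³ (λ b c d → f zero (suc b) (suc c) (suc d)))))
         + (((sum (λ a → f (suc a) zero zero zero) + ∑² (λ a d → f (suc a) zero zero (suc d)))
             + (∑² (λ a c → f (suc a) zero (suc c) zero) + ∑³ (λ a c d → f (suc a) zero (suc c) (suc d))))
            + ((∑² (λ a b → f (suc a) (suc b) zero zero) + ∑³ (λ a b d → f (suc a) (suc b) zero (suc d)))
               + (∑³ (λ a b c → f (suc a) (suc b) (suc c) zero) + ∑⁴ (λ a b c d → f (suc a) (suc b) (suc c) (suc d)))))
  ∑⁴-split f = cong₂ _+_ (∑³-split (f zero)) (begin
    sum (λ a → ∑³ (f (suc a)))
      ≡⟨ sum-cong-≋ (λ a → ∑³-split (f (suc a))) ⟩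
    sum (λ a → ((t₁ a + t₂ a) + (t₃ a + t₄ a)) + ((t₅ a + t₆ a) + (t₇ a + t₈ a)))
      ≡⟨ ∑-distrib-+ (λ a → (t₁ a + t₂ a) + (t₃ a + t₄ a)) (λ a → (t₅ a + t₆ a) + (t₇ a + t₈ a)) ⟩
    sum (λ a → (t₁ a + t₂ a) + (t₃ a + t₄ a)) + sum (λ a → (t₅ a + t₆ a) + (t₇ a + t₈ a))
      ≡⟨ cong₂ _+_ (∑-distrib-+₄ t₁ t₂ t₃ t₄) (∑-distrib-+₄ t₅ t₆ t₇ t₈) ⟩
    ((sum t₁ + sum t₂) + (sum t₃ + sum t₄)) + ((sum t₅ + sum t₆) + (sum t₇ + sum t₈)) ∎)
    where
    open ≡-Reasoning
    t₁ t₂ t₃ t₄ t₅ t₆ t₇ t₈ : Fin _ → ℤ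
    t₁ a = f (suc a) zero zero zero
    t₂ a = sum λ d → f (suc a) zero zero (suc d)
    t₃ a = sum λ c → f (suc a) zero (suc c) zero
    t₄ a = ∑² λ c d → f (suc a) zero (suc c) (suc d)
    t₅ a = sum λ b → f (suc a) (suc b) zero zero
    t₆ a = ∑² λ b d → f (suc a) (suc b) zero (suc d)
    t₇ a = ∑² λ b c → f (suc a) (suc b) (suc c) zero
    t₈ a = ∑³ λ b c d → f (suc a) (suc b) (suc c) (suc d)

  record Symmetric₄ {n} (f : Fin n → Fin n → Fin n → Fin n → ℤ) : Set where
    field
      swap₁₂ : ∀ a b c d → f a b c d ≡ f b a c d
      swap₂₃ : ∀ a b c d → f a b c d ≡ f a c b d
      swap₃₄ : ∀ a b c d → f a b c d ≡ f a b d c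
      diag₁₂ : ∀ a c d → f a a c d ≡ + 0
      diag₁₃ : ∀ a b d → f a b a d ≡ + 0
      diag₁₄ : ∀ a b c → f a b c a ≡ + 0
      diag₂₃ : ∀ a b d → f a b b d ≡ + 0
      diag₂₄ : ∀ a b c → f a b c b ≡ + 0
      diag₃₄ : ∀ a b c → f a b c c ≡ + 0

  -- Over Fin (suc n), terms with two arguments zero vanish and the four with one zero agree by symmetry.
  ∑⁴-symmetric : ∀ n (f : Fin n → Fin n → Fin n → Fin n → ℤ) → Symmetric₄ f → ∑⁴ f ≡ + 24 * ∑<⁴ n f
  ∑⁴-symmetric zero    f sym = refl
  ∑⁴-symmetric (suc n) f sym = begin
    ∑⁴ f
      ≡⟨ ∑⁴-split f ⟩
    _ ≡⟨ cong₂ _+_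
           (cong₂ _+_ (cong₂ _+_ (cong₂ _+_ (diag₁₂ zero zero zero) (sum-zero λ d → diag₁₂ zero zero (suc d)))
                                 (cong₂ _+_ (sum-zero λ c → diag₁₂ zero (suc c) zero) (∑²-zero λ c d → diag₁₂ zero (suc c) (suc d))))
                      (cong₂ _+_ (cong₂ _+_ (sum-zero λ b → diag₁₃ zero (suc b) zero) (∑²-zero λ b d → diag₁₃ zero (suc b) (suc d)))
                                 (cong₂ _+_ (∑²-zero λ b c → diag₁₄ zero (suc b) (suc c)) ∑³g)))
           (cong₂ _+_ (cong₂ _+_ (cong₂ _+_ (sum-zero λ a → diag₂₃ (suc a) zero zero) (∑²-zero λ a d → diag₂₃ (suc a) zero (suc d)))
                                 (cong₂ _+_ (∑²-zero λ a c → diag₂₄ (suc a) zero (suc c))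
                                            (trans (∑³-cong λ a c d → swap₁₂ (suc a) zero (suc c) (suc d)) ∑³g)))
                      (cong₂ _+_ (cong₂ _+_ (∑²-zero λ a b → diag₃₄ (suc a) (suc b) zero)
                                            (trans (∑³-cong λ a b d → trans (swap₂₃ (suc a) (suc b) zero (suc d))
                                                                            (swap₁₂ (suc a) zero (suc b) (suc d))) ∑³g))
                                 (cong₂ _+_ (trans (∑³-cong λ a b c → trans (swap₃₄ (suc a) (suc b) (suc c) zero)
                                                                     (trans (swap₂₃ (suc a) (suc b) zero (suc c))
                                                                            (swap₁₂ (suc a) zero (suc b) (suc c)))) ∑³g)
                                            (∑⁴-symmetric n f↑ sym↑)))) ⟩
    ((((+ 0 + + 0) + (+ 0 + + 0)) + ((+ 0 + + 0) + (+ 0 + + 6 * Q)))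
     + (((+ 0 + + 0) + (+ 0 + + 6 * Q)) + ((+ 0 + + 6 * Q) + (+ 6 * Q + + 24 * R))))
      ≡⟨ lemma Q R ⟩
    + 24 * (Q + R) ∎
    where
    open ≡-Reasoning
    open Symmetric₄ sym
    g : Fin n → Fin n → Fin n → ℤ
    g b c d = f zero (suc b) (suc c) (suc d)
    f↑ : Fin n → Fin n → Fin n → Fin n → ℤ
    f↑ a b c d = f (suc a) (suc b) (suc c) (suc d)
    sym↑ : Symmetric₄ f↑
    sym↑ = record
      { swap₁₂ = λ a b c d → swap₁₂ _ _ _ _ ; swap₂₃ = λ a b c d → swap₂₃ _ _ _ _ ; swap₃₄ = λ a b c d → swap₃₄ _ _ _ _
      ; diag₁₂ = λ a c d → diag₁₂ _ _ _ ; diag₁₃ = λ a b d → diag₁₃ _ _ _ ; diag₁₄ = λ a b c → diag₁₄ _ _ _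
      ; diag₂₃ = λ a b d → diag₂₃ _ _ _ ; diag₂₄ = λ a b c → diag₂₄ _ _ _ ; diag₃₄ = λ a b c → diag₃₄ _ _ _ }
    Q = ∑<³ n g
    R = ∑<⁴ n f↑
    ∑³g : ∑³ g ≡ + 6 * Q
    ∑³g = ∑³-symmetric n g record
      { swap₁₂ = λ b c d → swap₂₃ zero (suc b) (suc c) (suc d) ; swap₂₃ = λ b c d → swap₃₄ zero (suc b) (suc c) (suc d)
      ; diag₁₂ = λ b d → diag₂₃ zero (suc b) (suc d) ; diag₁₃ = λ b c → diag₂₄ zero (suc b) (suc c)
      ; diag₂₃ = λ b c → diag₃₄ zero (suc b) (suc c) }
    lemma : ∀ q r → ((((+ 0 + + 0) + (+ 0 + + 0)) + ((+ 0 + + 0) + (+ 0 + + 6 * q)))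
                     + (((+ 0 + + 0) + (+ 0 + + 6 * q)) + ((+ 0 + + 6 * q) + (+ 6 * q + + 24 * r)))) ≡ + 24 * (q + r)
    lemma = solve-∀

  ψ : ℤ → ℤ → ℤ → ℤ
  ψ p q r = p * p + q * q + r * r + - + 2 * (p * q + p * r + q * r)

  ψ-swap₁₂ : ∀ p q r → ψ p q r ≡ ψ q p r
  ψ-swap₁₂ = identity
    where
    identity : ∀ p q r → p * p + q * q + r * r + - + 2 * (p * q + p * r + q * r)
                       ≡ q * q + p * p + r * r + - + 2 * (q * p + q * r + p * r)
    identity = solve-∀

  ψ-swap₂₃ : ∀ p q r → ψ p q r ≡ ψ p r q
  ψ-swap₂₃ = identity
    where
    identity : ∀ p q r → p * p + q * q + r * r + - + 2 * (p * q + p * r + q * r)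
                       ≡ p * p + r * r + q * q + - + 2 * (p * r + p * q + r * q)
    identity = solve-∀

  ψ-zero : ∀ q → ψ (+ 0) q q ≡ + 0
  ψ-zero = identity
    where
    identity : ∀ q → + 0 * + 0 + q * q + q * q + - + 2 * (+ 0 * q + + 0 * q + q * q) ≡ + 0
    identity = solve-∀

  symmetric₄ : (p q r s t o : ℤ) → Fin 4 → Fin 4 → ℤ
  symmetric₄ p q r s t o = (+ 0 Vector.∷ p Vector.∷ q Vector.∷ r Vector.∷ Vector.[])
                   Vector.∷ (p Vector.∷ + 0 Vector.∷ s Vector.∷ t Vector.∷ Vector.[])
                   Vector.∷ (q Vector.∷ s Vector.∷ + 0 Vector.∷ o Vector.∷ Vector.[])
                   Vector.∷ (r Vector.∷ t Vector.∷ o Vector.∷ + 0 Vector.∷ Vector.[])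
                   Vector.∷ Vector.[]

  det-symmetric₄ : ∀ p q r s t o → detℤ (symmetric₄ (- p) (- q) (- r) (- s) (- t) (- o)) ≡ ψ (p * o) (q * t) (r * s)
  det-symmetric₄ = identity
    where
    -- detℤ unfolded, so that the ring solver sees the polynomial.
    identity : ∀ p q r s t o →
      let Δ₁ : ℤ → ℤ
          Δ₁ a = + 1 * (a * + 1) + + 0
          Δ₂ : ℤ → ℤ → ℤ → ℤ → ℤ
          Δ₂ a b c d = + 1 * (a * Δ₁ d) + (- + 1 * (b * Δ₁ c) + + 0)
          Δ₃ : ℤ → ℤ → ℤ → ℤ → ℤ → ℤ → ℤ → ℤ → ℤ → ℤ
          Δ₃ a b c d e f g h i = + 1 * (a * Δ₂ e f h i) + (- + 1 * (b * Δ₂ d f g i) + (+ 1 * (c * Δ₂ d e g h) + + 0))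
          z = + 0
      in + 1 * (z * Δ₃ z (- s) (- t) (- s) z (- o) (- t) (- o) z)
         + (- + 1 * (- p * Δ₃ (- p) (- s) (- t) (- q) z (- o) (- r) (- o) z)
         + (+ 1 * (- q * Δ₃ (- p) z (- t) (- q) (- s) (- o) (- r) (- t) z)
         + (- + 1 * (- r * Δ₃ (- p) z (- s) (- q) (- s) z (- r) (- t) (- o)) + + 0)))
         ≡ (p * o) * (p * o) + (q * t) * (q * t) + (r * s) * (r * s)
           + - + 2 * ((p * o) * (q * t) + (p * o) * (r * s) + (q * t) * (r * s))
    identity = solve-∀

  ψ-cong : ∀ {p p′ q q′ r r′} → p ≡ p′ → q ≡ q′ → r ≡ r′ → ψ p q r ≡ ψ p′ q′ r′
  ψ-cong refl refl refl = refl

  ψ-zero₁ : ∀ {p q r} → p ≡ + 0 → q ≡ r → ψ p q r ≡ + 0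
  ψ-zero₁ {q = q} refl refl = ψ-zero q

  ψ-zero₂ : ∀ {p q r} → q ≡ + 0 → p ≡ r → ψ p q r ≡ + 0
  ψ-zero₂ {p} {q} {r} q≡0 p≡r = trans (ψ-swap₁₂ p q r) (ψ-zero₁ q≡0 p≡r)

  ψ-zero₃ : ∀ {p q r} → r ≡ + 0 → p ≡ q → ψ p q r ≡ + 0
  ψ-zero₃ {p} {q} {r} r≡0 p≡q = trans (ψ-swap₂₃ p q r) (ψ-zero₂ r≡0 p≡q)

  ∑²-+ : ∀ {n} (f g : Fin n → Fin n → ℤ) → ∑² (λ a b → f a b + g a b) ≡ ∑² f + ∑² g
  ∑²-+ f g = trans (sum-cong-≋ λ a → ∑-distrib-+ (f a) (g a)) (∑-distrib-+ (λ a → sum (f a)) (λ a → sum (g a)))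

  ∑³-+ : ∀ {n} (f g : Fin n → Fin n → Fin n → ℤ) → ∑³ (λ a b c → f a b c + g a b c) ≡ ∑³ f + ∑³ g
  ∑³-+ f g = trans (sum-cong-≋ λ a → ∑²-+ (f a) (g a)) (∑-distrib-+ (λ a → ∑² (f a)) (λ a → ∑² (g a)))

  ∑⁴-+ : ∀ {n} (f g : Fin n → Fin n → Fin n → Fin n → ℤ) → ∑⁴ (λ a b c d → f a b c d + g a b c d) ≡ ∑⁴ f + ∑⁴ g
  ∑⁴-+ f g = trans (sum-cong-≋ λ a → ∑³-+ (f a) (g a)) (∑-distrib-+ (λ a → ∑³ (f a)) (λ a → ∑³ (g a)))

  ∑²-*ˡ : ∀ {n} x (f : Fin n → Fin n → ℤ) → ∑² (λ a b → x * f a b) ≡ x * ∑² f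
  ∑²-*ˡ x f = trans (sum-cong-≋ λ a → sym (*-distribˡ-sum x (f a))) (sym (*-distribˡ-sum x λ a → sum (f a)))

  ∑³-*ˡ : ∀ {n} x (f : Fin n → Fin n → Fin n → ℤ) → ∑³ (λ a b c → x * f a b c) ≡ x * ∑³ f
  ∑³-*ˡ x f = trans (sum-cong-≋ λ a → ∑²-*ˡ x (f a)) (sym (*-distribˡ-sum x λ a → ∑² (f a)))

  ∑⁴-*ˡ : ∀ {n} x (f : Fin n → Fin n → Fin n → Fin n → ℤ) → ∑⁴ (λ a b c d → x * f a b c d) ≡ x * ∑⁴ f
  ∑⁴-*ˡ x f = trans (sum-cong-≋ λ a → ∑³-*ˡ x (f a)) (sym (*-distribˡ-sum x λ a → ∑³ (f a)))

  ∑⁴-swap₂₃ : ∀ {n} (f : Fin n → Fin n → Fin n → Fin n → ℤ) → ∑⁴ f ≡ ∑⁴ (λ a b c d → f a c b d)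
  ∑⁴-swap₂₃ f = sum-cong-≋ λ a → ∑-comm λ b c → sum (f a b c)

  ∑⁴-swap₃₄ : ∀ {n} (f : Fin n → Fin n → Fin n → Fin n → ℤ) → ∑⁴ f ≡ ∑⁴ (λ a b c d → f a b d c)
  ∑⁴-swap₃₄ f = sum-cong-≋ λ a → sum-cong-≋ λ b → ∑-comm (f a b)

  ∑⁴-product : ∀ {n} (f g : Fin n → Fin n → ℤ) → ∑⁴ (λ a b c d → f a b * g c d) ≡ ∑² f * ∑² g
  ∑⁴-product f g = begin
    ∑⁴ (λ a b c d → f a b * g c d)          ≡⟨ sum-cong-≋ (λ a → sum-cong-≋ λ b → ∑²-*ˡ (f a b) g) ⟩
    sum (λ a → sum λ b → f a b * ∑² g)      ≡⟨ sum-cong-≋ (λ a → sym (*-distribʳ-sum (∑² g) (f a))) ⟩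
    sum (λ a → sum (f a) * ∑² g)            ≡⟨ sym (*-distribʳ-sum (∑² g) λ a → sum (f a)) ⟩
    ∑² f * ∑² g                             ∎
    where open ≡-Reasoning

  ∑⁴-swap₂₄ : ∀ {n} (f : Fin n → Fin n → Fin n → Fin n → ℤ) → ∑⁴ f ≡ ∑⁴ (λ a b c d → f a d c b)
  ∑⁴-swap₂₄ f = trans (∑⁴-swap₂₃ f) (trans (∑⁴-swap₃₄ (λ a b c d → f a c b d)) (∑⁴-swap₂₃ (λ a b c d → f a d b c)))

  symmetric₄-entries : (M : Fin 4 → Fin 4 → ℤ) → (∀ i j → M i j ≡ M j i) → (∀ i → M i i ≡ + 0) →
    ∀ i j → M i j ≡ symmetric₄ (M 0F 1F) (M 0F 2F) (M 0F 3F) (M 1F 2F) (M 1F 3F) (M 2F 3F) i j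
  symmetric₄-entries M M-sym M-diag 0F 0F = M-diag 0F
  symmetric₄-entries M M-sym M-diag 0F 1F = refl
  symmetric₄-entries M M-sym M-diag 0F 2F = refl
  symmetric₄-entries M M-sym M-diag 0F 3F = refl
  symmetric₄-entries M M-sym M-diag 1F 0F = M-sym 1F 0F
  symmetric₄-entries M M-sym M-diag 1F 1F = M-diag 1F
  symmetric₄-entries M M-sym M-diag 1F 2F = refl
  symmetric₄-entries M M-sym M-diag 1F 3F = refl
  symmetric₄-entries M M-sym M-diag 2F 0F = M-sym 2F 0F
  symmetric₄-entries M M-sym M-diag 2F 1F = M-sym 2F 1F
  symmetric₄-entries M M-sym M-diag 2F 2F = M-diag 2F
  symmetric₄-entries M M-sym M-diag 2F 3F = refl
  symmetric₄-entries M M-sym M-diag 3F 0F = M-sym 3F 0F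
  symmetric₄-entries M M-sym M-diag 3F 1F = M-sym 3F 1F
  symmetric₄-entries M M-sym M-diag 3F 2F = M-sym 3F 2F
  symmetric₄-entries M M-sym M-diag 3F 3F = M-diag 3F

  quadruple : ∀ {n} → Fin n → Fin n → Fin n → Fin n → Fin 4 → Fin n
  quadruple a b c d = a Vector.∷ b Vector.∷ c Vector.∷ d Vector.∷ Vector.[]

  pairingForm : ∀ {n} → (Fin n → Fin n → ℤ) → Fin n → Fin n → Fin n → Fin n → ℤ
  pairingForm A a b c d = ψ (A a b * A c d) (A a c * A b d) (A a d * A b c)

  principalMinor-quadruple-η : ∀ {n} (M : Fin n → Fin n → ℤ) (t : Fin 4 → Fin n) →
                               principalMinor M t ≡ principalMinor M (quadruple (t 0F) (t 1F) (t 2F) (t 3F))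
  principalMinor-quadruple-η M t = principalMinor-cong M {t} {quadruple (t 0F) (t 1F) (t 2F) (t 3F)} η
    where
    η : ∀ i → t i ≡ quadruple (t 0F) (t 1F) (t 2F) (t 3F) i
    η 0F = refl
    η 1F = refl
    η 2F = refl
    η 3F = refl

  closedWalks₄ : ∀ {n} → (Fin n → Fin n → ℤ) → ℤ
  closedWalks₄ A = ∑⁴ λ a b c d → A a b * A b c * A c d * A d a

  module _ {n} (A : Fin n → Fin n → ℤ) (A-sym : ∀ u v → A u v ≡ A v u) (A-diag : ∀ u → A u u ≡ + 0) where

    principalMinor-quadruple : ∀ a b c d → principalMinor (negate A) (quadruple a b c d) ≡ pairingForm A a b c d
    principalMinor-quadruple a b c d =
      trans (detℤ-cong (symmetric₄-entries M (λ i j → cong -_ (A-sym (quadruple a b c d i) (quadruple a b c d j)))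
                                             (λ i → cong -_ (A-diag (quadruple a b c d i)))))
            (det-symmetric₄ (A a b) (A a c) (A a d) (A b c) (A b d) (A c d))
      where
      M : Fin 4 → Fin 4 → ℤ
      M r s = - A (quadruple a b c d r) (quadruple a b c d s)

    pairingForm-symmetric : Symmetric₄ (pairingForm A)
    pairingForm-symmetric = record
      { swap₁₂ = λ a b c d → trans (ψ-swap₂₃ (A a b * A c d) (A a c * A b d) (A a d * A b c))
                                   (ψ-cong (cong (_* A c d) (A-sym a b)) (ℤ.*-comm (A a d) (A b c)) (ℤ.*-comm (A a c) (A b d)))
      ; swap₂₃ = λ a b c d → trans (ψ-swap₁₂ (A a b * A c d) (A a c * A b d) (A a d * A b c))
                                   (cong (λ x → ψ (A a c * A b d) (A a b * A c d) (A a d * x)) (A-sym b c))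
      ; swap₃₄ = λ a b c d → trans (ψ-swap₂₃ (A a b * A c d) (A a c * A b d) (A a d * A b c))
                                   (cong (λ x → ψ (A a b * x) (A a d * A b c) (A a c * A b d)) (A-sym c d))
      ; diag₁₂ = λ a c d → ψ-zero₁ (entry≡0ˡ (A c d) (A-diag a)) (ℤ.*-comm (A a c) (A a d))
      ; diag₁₃ = λ a b d → ψ-zero₂ (entry≡0ˡ (A b d) (A-diag a)) (trans (ℤ.*-comm (A a b) (A a d)) (cong (A a d *_) (A-sym a b)))
      ; diag₁₄ = λ a b c → ψ-zero₃ (entry≡0ˡ (A b c) (A-diag a)) (trans (ℤ.*-comm (A a b) (A c a)) (cong₂ _*_ (A-sym c a) (A-sym a b)))
      ; diag₂₃ = λ a b d → ψ-zero₃ {p = A a b * A b d} (entry≡0ʳ (A a d) (A-diag b)) refl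
      ; diag₂₄ = λ a b c → ψ-zero₂ (entry≡0ʳ (A a c) (A-diag b)) (cong (A a b *_) (A-sym c b))
      ; diag₃₄ = λ a b c → ψ-zero₁ {q = A a c * A b c} (entry≡0ʳ (A a b) (A-diag c)) refl
      }
      where
      entry≡0ˡ : ∀ {x} y → x ≡ + 0 → x * y ≡ + 0
      entry≡0ˡ y refl = ℤ.*-zeroˡ y
      entry≡0ʳ : ∀ x {y} → y ≡ + 0 → x * y ≡ + 0
      entry≡0ʳ x refl = ℤ.*-zeroʳ x

    ∑⁴-pairingForm : (∀ u v → A u v * A u v ≡ A u v) →
                     ∑⁴ (pairingForm A) ≡ + 3 * (∑² A * ∑² A) - + 6 * closedWalks₄ A
    ∑⁴-pairingForm A-idem = begin
      ∑⁴ (pairingForm A)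
        ≡⟨ ∑⁴-+ squares (λ a b c d → - + 2 * crossTerms a b c d) ⟩
      ∑⁴ squares + ∑⁴ (λ a b c d → - + 2 * crossTerms a b c d)
        ≡⟨ cong (λ x → ∑⁴ squares + x) (∑⁴-*ˡ (- + 2) crossTerms) ⟩
      ∑⁴ squares + - + 2 * ∑⁴ crossTerms
        ≡⟨ cong₂ (λ x y → x + - + 2 * y)
                 (trans (∑⁴-+ (λ a b c d → P a b c d * P a b c d + Q a b c d * Q a b c d) (λ a b c d → R a b c d * R a b c d))
                        (cong₂ _+_ (trans (∑⁴-+ (λ a b c d → P a b c d * P a b c d) (λ a b c d → Q a b c d * Q a b c d))
                                          (cong₂ _+_ ∑P² ∑Q²)) ∑R²))
                 (trans (∑⁴-+ (λ a b c d → P a b c d * Q a b c d + P a b c d * R a b c d) (λ a b c d → Q a b c d * R a b c d))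
                        (cong₂ _+_ (trans (∑⁴-+ (λ a b c d → P a b c d * Q a b c d) (λ a b c d → P a b c d * R a b c d))
                                          (cong₂ _+_ ∑PQ ∑PR)) ∑QR)) ⟩
      (S * S + S * S + S * S) + - + 2 * (W + W + W)
        ≡⟨ lemma S W ⟩
      + 3 * (S * S) - + 6 * W ∎
      where
      open ≡-Reasoning
      S = ∑² A
      W = closedWalks₄ A
      P Q R : Fin n → Fin n → Fin n → Fin n → ℤ
      P a b c d = A a b * A c d
      Q a b c d = A a c * A b d
      R a b c d = A a d * A b c
      squares crossTerms : Fin n → Fin n → Fin n → Fin n → ℤ
      squares a b c d = P a b c d * P a b c d + Q a b c d * Q a b c d + R a b c d * R a b c d
      crossTerms a b c d = P a b c d * Q a b c d + P a b c d * R a b c d + Q a b c d * R a b c d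
      product-idem : ∀ x y → x * y * (x * y) ≡ x * x * (y * y)
      product-idem = solve-∀
      rearrange : ∀ x y z w → x * y * (z * w) ≡ x * w * y * z
      rearrange = solve-∀
      idem : ∀ u v u′ v′ → A u v * A u′ v′ * (A u v * A u′ v′) ≡ A u v * A u′ v′
      idem u v u′ v′ = trans (product-idem (A u v) (A u′ v′)) (cong₂ _*_ (A-idem u v) (A-idem u′ v′))
      ∑P² : ∑⁴ (λ a b c d → P a b c d * P a b c d) ≡ S * S
      ∑P² = trans (∑⁴-cong λ a b c d → idem a b c d) (∑⁴-product A A)
      ∑Q² : ∑⁴ (λ a b c d → Q a b c d * Q a b c d) ≡ S * S
      ∑Q² = trans (∑⁴-cong λ a b c d → idem a c b d) (trans (sym (∑⁴-swap₂₃ P)) (∑⁴-product A A))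
      ∑R² : ∑⁴ (λ a b c d → R a b c d * R a b c d) ≡ S * S
      ∑R² = trans (∑⁴-cong λ a b c d → trans (idem a d b c) (cong (A a d *_) (A-sym b c)))
                  (trans (sym (∑⁴-swap₂₄ P)) (∑⁴-product A A))
      ∑PQ : ∑⁴ (λ a b c d → P a b c d * Q a b c d) ≡ W
      ∑PQ = trans (∑⁴-cong λ a b c d → trans (cong₂ (λ x y → A a b * x * (y * A b d)) (A-sym c d) (A-sym a c))
                                              (rearrange (A a b) (A d c) (A c a) (A b d)))
                  (sym (∑⁴-swap₃₄ λ a b c d → A a b * A b c * A c d * A d a))
      ∑PR : ∑⁴ (λ a b c d → P a b c d * R a b c d) ≡ W
      ∑PR = ∑⁴-cong λ a b c d → trans (cong (λ x → A a b * A c d * (x * A b c)) (A-sym a d))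
                                       (rearrange (A a b) (A c d) (A d a) (A b c))
      ∑QR : ∑⁴ (λ a b c d → Q a b c d * R a b c d) ≡ W
      ∑QR = trans (∑⁴-cong λ a b c d → trans (cong₂ (λ x y → A a c * A b d * (x * y)) (A-sym a d) (A-sym b c))
                                              (rearrange (A a c) (A b d) (A d a) (A c b)))
                  (sym (∑⁴-swap₂₃ λ a b c d → A a b * A b c * A c d * A d a))
      lemma : ∀ s w → (s * s + s * s + s * s) + - + 2 * (w + w + w) ≡ + 3 * (s * s) - + 6 * w
      lemma = solve-∀

  module _ {n} (G : Graph n) where

    adjMatrix-sym : ∀ u v → adjMatrix G u v ≡ adjMatrix G v u
    adjMatrix-sym u v = cong (λ b → if b then + 1 else + 0) (Graph.sym G u v)

    adjMatrix-diag : ∀ u → adjMatrix G u u ≡ + 0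
    adjMatrix-diag u = cong (λ b → if b then + 1 else + 0) (Graph.irrefl G u)

    adjMatrix-idem : ∀ u v → adjMatrix G u v * adjMatrix G u v ≡ adjMatrix G u v
    adjMatrix-idem u v with adj G u v
    ... | true  = refl
    ... | false = refl

    -- The diagonal λ part of the matrix is local to charPoly, so the matrix is found by unification.
    charMatrix : Σ (Fin n → Fin n → Poly) λ M → charPoly G ≡ det M
    charMatrix = _ , refl

    charMatrix-isPencil : IsPencil (proj₁ charMatrix) δ (adjMatrix G)
    charMatrix-isPencil = record { coeff₀ = coeff₀ ; coeff₁ = coeff₁ ; coeff₂₊ = coeff₂₊ }
      where
      coeff₀ : ∀ u v → coeff (proj₁ charMatrix u v) 0 ≡ - adjMatrix G u v
      coeff₀ u v with u ≟ v
      ... | yes _ = trans (ℤ.+-identityˡ (- + 1 * adjMatrix G u v)) (ℤ.-1*i≡-i (adjMatrix G u v))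
      ... | no  _ = ℤ.-1*i≡-i (adjMatrix G u v)
      coeff₁ : ∀ u v → coeff (proj₁ charMatrix u v) 1 ≡ δ u v
      coeff₁ u v with u ≟ v
      ... | yes _ = refl
      ... | no  _ = refl
      coeff₂₊ : ∀ u v i → coeff (proj₁ charMatrix u v) (2 ℕ.+ i) ≡ + 0
      coeff₂₊ u v i with u ≟ v
      ... | yes _ = refl
      ... | no  _ = refl

    a₄-coeff : 4 ≤ n → a 4 G ≡ coeff (charPoly G) (n ∸ 4)
    a₄-coeff 4≤n with 4 ≤? n
    ... | yes _   = refl
    ... | no 4≰n = ⊥-elim (4≰n 4≤n)

    a₄-small : n ℕ.< 4 → a 4 G ≡ + 0
    a₄-small n<4 with 4 ≤? n
    ... | yes 4≤n = ⊥-elim (ℕ.<⇒≱ n<4 4≤n)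
    ... | no _    = refl

    principalMinor≡pairingForm : ∀ (t : Fin 4 → Fin n) →
                                 principalMinor (negate (adjMatrix G)) t ≡ pairingForm (adjMatrix G) (t 0F) (t 1F) (t 2F) (t 3F)
    principalMinor≡pairingForm t =
      trans (principalMinor-quadruple-η (negate (adjMatrix G)) t)
            (principalMinor-quadruple (adjMatrix G) adjMatrix-sym adjMatrix-diag (t 0F) (t 1F) (t 2F) (t 3F))

    a₄≡∑pairingForm-small : n ℕ.< 4 → a 4 G ≡ ∑<⁴ n (pairingForm (adjMatrix G))
    a₄≡∑pairingForm-small n<4 =
      trans (a₄-small n<4) (sym (∑Increasing-tooLong n 4 (λ t → pairingForm (adjMatrix G) (t 0F) (t 1F) (t 2F) (t 3F)) n<4))

    a₄≡∑pairingForm-large : 4 ≤ n → a 4 G ≡ ∑<⁴ n (pairingForm (adjMatrix G))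
    a₄≡∑pairingForm-large 4≤n = begin
      a 4 G
        ≡⟨ a₄-coeff 4≤n ⟩
      coeff (charPoly G) (n ∸ 4)
        ≡⟨ coeff-det-pencil n charMatrix-isPencil (n ∸ 4) 4 (ℕ.m∸n+n≡m 4≤n) ⟩
      ∑Choose n (n ∸ 4) 4 (detℤ ∘ mix δ (adjMatrix G))
        ≡⟨ ∑Choose-cong n (n ∸ 4) 4 (λ T → det-mix-identity n T δ (adjMatrix G) (λ r c → refl)) ⟩
      ∑Choose n (n ∸ 4) 4 (principalMinor (negate (adjMatrix G)) ∘ chosen)
        ≡⟨ ∑Choose-chosen n (n ∸ 4) 4 _ (principalMinor-cong (negate (adjMatrix G))) (ℕ.m∸n+n≡m 4≤n) ⟩
      ∑Increasing n 4 (principalMinor (negate (adjMatrix G)))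
        ≡⟨ ∑Increasing-cong n 4 principalMinor≡pairingForm ⟩
      ∑<⁴ n (pairingForm (adjMatrix G)) ∎
      where open ≡-Reasoning

    a₄≡∑pairingForm : a 4 G ≡ ∑<⁴ n (pairingForm (adjMatrix G))
    a₄≡∑pairingForm = [ a₄≡∑pairingForm-large , a₄≡∑pairingForm-small ]′ (ℕ.≤-<-connex 4 n)

    twentyFour-a₄ : + 24 * a 4 G ≡ + 3 * (∑² (adjMatrix G) * ∑² (adjMatrix G)) - + 6 * closedWalks₄ (adjMatrix G)
    twentyFour-a₄ = begin
      + 24 * a 4 G                        ≡⟨ cong (+ 24 *_) a₄≡∑pairingForm ⟩
      + 24 * ∑<⁴ n (pairingForm A)        ≡⟨ sym (∑⁴-symmetric n (pairingForm A) (pairingForm-symmetric A adjMatrix-sym adjMatrix-diag)) ⟩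
      ∑⁴ (pairingForm A)                  ≡⟨ ∑⁴-pairingForm A adjMatrix-sym adjMatrix-diag adjMatrix-idem ⟩
      + 3 * (∑² A * ∑² A) - + 6 * closedWalks₄ A ∎
      where
      open ≡-Reasoning
      A = adjMatrix G

module DifferenceGraphCounting where

  open import Data.Bool using (Bool; true; false; if_then_else_; T; _∧_)
  open import Data.Bool.Properties using (∧-zeroʳ)
  open import Data.Empty using (⊥; ⊥-elim)
  open import Data.Fin using (Fin; zero; suc)
  open import Data.Nat
  open import Data.Nat.Properties
  open import Data.Nat.Tactic.RingSolver using (solve-∀)
  open import Data.Sum using (inj₁; inj₂)
  open import Relation.Binary.PropositionalEquality
  open import Relation.Nullary.Reflects using (ofʸ; ofⁿ)

  open import Defs using (sumRange-aux; sumFrom_to_of_; sumFin; Graph; DiffLabelling; side; index; index-pos; index-le; Side; sideX; sideY; isSide; xCount; yCount)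

  ≤ᵇ-true : ∀ {m n} → m ≤ n → (m ≤ᵇ n) ≡ true
  ≤ᵇ-true {m} {n} m≤n with m ≤ᵇ n | ≤ᵇ-reflects-≤ m n
  ... | true  | _        = refl
  ... | false | ofⁿ m≰n = ⊥-elim (m≰n m≤n)

  ≤ᵇ-false : ∀ {m n} → n < m → (m ≤ᵇ n) ≡ false
  ≤ᵇ-false {m} {n} n<m with m ≤ᵇ n | ≤ᵇ-reflects-≤ m n
  ... | true  | ofʸ m≤n = ⊥-elim (<⇒≱ n<m m≤n)
  ... | false | _        = refl

  if-≤ᵇ-yes : ∀ {A : Set} {m n} {a b : A} → m ≤ n → (if m ≤ᵇ n then a else b) ≡ a
  if-≤ᵇ-yes {a = a} {b} m≤n = cong (λ c → if c then a else b) (≤ᵇ-true m≤n)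

  if-≤ᵇ-no : ∀ {A : Set} {m n} {a b : A} → n < m → (if m ≤ᵇ n then a else b) ≡ b
  if-≤ᵇ-no {a = a} {b} n<m = cong (λ c → if c then a else b) (≤ᵇ-false n<m)

  sumRange-congᵢ : ∀ a m {f g : ℕ → ℕ} → (∀ i → a ≤ i → i < a + m → f i ≡ g i) → sumRange-aux a m f ≡ sumRange-aux a m g
  sumRange-congᵢ a zero    f≡g = refl
  sumRange-congᵢ a (suc m) f≡g = cong₂ _+_
    (f≡g a ≤-refl (subst (a <_) (sym (+-suc a m)) (s≤s (m≤m+n a m))))
    (sumRange-congᵢ (suc a) m λ i a<i i<a+m → f≡g i (≤-trans (n≤1+n a) a<i) (subst (i <_) (sym (+-suc a m)) i<a+m))

  sumRange-cong : ∀ a m {f g : ℕ → ℕ} → (∀ i → f i ≡ g i) → sumRange-aux a m f ≡ sumRange-aux a m g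
  sumRange-cong a m f≡g = sumRange-congᵢ a m λ i _ _ → f≡g i

  sumRange-zeroᵢ : ∀ a m (f : ℕ → ℕ) → (∀ i → a ≤ i → i < a + m → f i ≡ 0) → sumRange-aux a m f ≡ 0
  sumRange-zeroᵢ a m f f≡0 = trans (sumRange-congᵢ a m f≡0) (zeros a m)
    where
    zeros : ∀ a m → sumRange-aux a m (λ _ → 0) ≡ 0
    zeros a zero    = refl
    zeros a (suc m) = zeros (suc a) m

  sumRange-+ : ∀ a m (f g : ℕ → ℕ) → sumRange-aux a m (λ i → f i + g i) ≡ sumRange-aux a m f + sumRange-aux a m g
  sumRange-+ a zero    f g = refl
  sumRange-+ a (suc m) f g =
    trans (cong (f a + g a +_) (sumRange-+ (suc a) m f g)) (lemma (f a) (g a) (sumRange-aux (suc a) m f) (sumRange-aux (suc a) m g))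
    where
    lemma : ∀ p q r s → (p + q) + (r + s) ≡ (p + r) + (q + s)
    lemma = solve-∀

  sumRange-*ˡ : ∀ a m c (f : ℕ → ℕ) → sumRange-aux a m (λ i → c * f i) ≡ c * sumRange-aux a m f
  sumRange-*ˡ a zero    c f = sym (*-zeroʳ c)
  sumRange-*ˡ a (suc m) c f =
    trans (cong (c * f a +_) (sumRange-*ˡ (suc a) m c f)) (sym (*-distribˡ-+ c (f a) (sumRange-aux (suc a) m f)))

  sumRange-*ʳ : ∀ a m c (f : ℕ → ℕ) → sumRange-aux a m (λ i → f i * c) ≡ sumRange-aux a m f * c
  sumRange-*ʳ a m c f = trans (sumRange-cong a m λ i → *-comm (f i) c) (trans (sumRange-*ˡ a m c f) (*-comm c _))

  sumRange-comm : ∀ a m b l (f : ℕ → ℕ → ℕ) →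
    sumRange-aux a m (λ i → sumRange-aux b l (f i)) ≡ sumRange-aux b l (λ j → sumRange-aux a m (λ i → f i j))
  sumRange-comm a zero    b l f = sym (sumRange-zeroᵢ b l _ λ _ _ _ → refl)
  sumRange-comm a (suc m) b l f =
    trans (cong (sumRange-aux b l (f a) +_) (sumRange-comm (suc a) m b l f)) (sym (sumRange-+ b l (f a) _))

  sumRange-product : ∀ a m b l (f g : ℕ → ℕ) →
    sumRange-aux a m f * sumRange-aux b l g ≡ sumRange-aux a m (λ i → sumRange-aux b l λ j → f i * g j)
  sumRange-product a m b l f g =
    trans (sym (sumRange-*ʳ a m (sumRange-aux b l g) f)) (sumRange-cong a m λ i → sym (sumRange-*ˡ b l (f i) g))

  sumRange-++ : ∀ a m l (f : ℕ → ℕ) → sumRange-aux a (m + l) f ≡ sumRange-aux a m f + sumRange-aux (a + m) l f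
  sumRange-++ a zero    l f = cong (λ b → sumRange-aux b l f) (sym (+-identityʳ a))
  sumRange-++ a (suc m) l f = trans
    (cong (f a +_) (trans (sumRange-++ (suc a) m l f) (cong (λ b → sumRange-aux (suc a) m f + sumRange-aux b l f) (sym (+-suc a m)))))
    (sym (+-assoc (f a) (sumRange-aux (suc a) m f) (sumRange-aux (a + suc m) l f)))

  sumRange-snoc : ∀ a m (f : ℕ → ℕ) → sumRange-aux a (suc m) f ≡ sumRange-aux a m f + f (a + m)
  sumRange-snoc a m f = begin
    sumRange-aux a (suc m) f                            ≡⟨ cong (λ l → sumRange-aux a l f) (+-comm 1 m) ⟩
    sumRange-aux a (m + 1) f                            ≡⟨ sumRange-++ a m 1 f ⟩
    sumRange-aux a m f + (f (a + m) + 0)                ≡⟨ cong (sumRange-aux a m f +_) (+-identityʳ (f (a + m))) ⟩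
    sumRange-aux a m f + f (a + m)                      ∎
    where open ≡-Reasoning

  sumRange-reflect : ∀ m a N (f : ℕ → ℕ) → a + m ≤ N →
                     sumRange-aux a m (λ i → f (N ∸ i)) ≡ sumRange-aux (suc (N ∸ (a + m))) m f
  sumRange-reflect zero    a N f a+m≤N = refl
  sumRange-reflect (suc m) a N f a+m≤N = begin
    f (N ∸ a) + sumRange-aux (suc a) m (λ i → f (N ∸ i))
      ≡⟨ cong (f (N ∸ a) +_) (sumRange-reflect m (suc a) N f (subst (_≤ N) (+-suc a m) a+m≤N)) ⟩
    f (N ∸ a) + sumRange-aux (suc (N ∸ (suc a + m))) m f
      ≡⟨ +-comm (f (N ∸ a)) _ ⟩
    sumRange-aux (suc (N ∸ (suc a + m))) m f + f (N ∸ a)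
      ≡⟨ cong₂ (λ b c → sumRange-aux (suc (N ∸ b)) m f + f c) (sym (+-suc a m)) N∸a ⟩
    sumRange-aux (suc (N ∸ (a + suc m))) m f + f (suc (N ∸ (a + suc m)) + m)
      ≡⟨ sym (sumRange-snoc (suc (N ∸ (a + suc m))) m f) ⟩
    sumRange-aux (suc (N ∸ (a + suc m))) (suc m) f ∎
    where
    open ≡-Reasoning
    d = N ∸ (a + suc m)
    N∸a : N ∸ a ≡ suc d + m
    N∸a = begin
      N ∸ a                       ≡⟨ cong (_∸ a) (sym (m∸n+n≡m a+m≤N)) ⟩
      d + (a + suc m) ∸ a         ≡⟨ cong (_∸ a) (lemma d a m) ⟩
      (suc d + m) + a ∸ a         ≡⟨ m+n∸n≡m (suc d + m) a ⟩
      suc d + m                   ∎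
      where
      lemma : ∀ d a m → d + (a + suc m) ≡ (suc d + m) + a
      lemma = solve-∀

  indicator : Bool → ℕ
  indicator b = if b then 1 else 0

  co-indicator : Bool → ℕ
  co-indicator b = if b then 0 else 1

  indicator-split : ∀ b₁ b₂ b₃ b₄ → (b₁ ≡ true → b₂ ≡ true → b₃ ≡ false → b₄ ≡ false → ⊥) →
    indicator b₁ * indicator b₂ ≡ indicator b₁ * (indicator b₂ * (indicator b₃ * indicator b₄))
                                  + indicator b₁ * (indicator b₂ * co-indicator b₃)
                                  + indicator b₁ * (indicator b₂ * co-indicator b₄)
  indicator-split false b₂    b₃    b₄    _ = refl
  indicator-split true  false b₃    b₄    _ = refl
  indicator-split true  true  true  true  _ = refl
  indicator-split true  true  true  false _ = refl
  indicator-split true  true  false true  _ = refl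
  indicator-split true  true  false false nested = ⊥-elim (nested refl refl refl refl)

  module _ (k : ℕ) where

    adjacent : ℕ → ℕ → ℕ
    adjacent i j = indicator (i + j ≤ᵇ suc k)

    apart : ℕ → ℕ → ℕ
    apart i j = co-indicator (i + j ≤ᵇ suc k)

    Σ₁ : (ℕ → ℕ) → ℕ
    Σ₁ = sumRange-aux 1 k

    Σ₄ : (ℕ → ℕ → ℕ → ℕ → ℕ) → ℕ
    Σ₄ F = Σ₁ λ i → Σ₁ λ j → Σ₁ λ i′ → Σ₁ λ j′ → F i j i′ j′

    Σ₄-swap₂₃ : ∀ F → Σ₄ F ≡ Σ₄ (λ i j i′ j′ → F i i′ j j′)
    Σ₄-swap₂₃ F = sumRange-cong 1 k λ i → sumRange-comm 1 k 1 k λ j i′ → Σ₁ (F i j i′)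

    Σ₂-weighted-square : ∀ (u : ℕ → ℕ) (g : ℕ → ℕ → ℕ → ℕ) →
      Σ₁ (λ a → u a * Σ₁ λ b → u b * (Σ₁ (g a b) * Σ₁ (g a b))) ≡ Σ₄ λ a b c d → u a * (u b * (g a b c * g a b d))
    Σ₂-weighted-square u g = sumRange-cong 1 k λ a → trans (cong (u a *_) (sumRange-cong 1 k λ b → cong (u b *_) (square a b)))
      (trans (sym (sumRange-*ˡ 1 k (u a) _)) (sumRange-cong 1 k λ b →
        trans (cong (u a *_) (sym (sumRange-*ˡ 1 k (u b) _)))
        (trans (sym (sumRange-*ˡ 1 k (u a) _)) (sumRange-cong 1 k λ c →
          trans (cong (u a *_) (sym (sumRange-*ˡ 1 k (u b) _))) (sym (sumRange-*ˡ 1 k (u a) _))))))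
      where
      square : ∀ a b → Σ₁ (g a b) * Σ₁ (g a b) ≡ Σ₁ λ c → Σ₁ λ d → g a b c * g a b d
      square a b = sumRange-product 1 k 1 k (g a b) (g a b)

    -- For edges ij and i′j′ one of i′j, ij′ is an edge too: the neighbourhoods are nested.
    adjacent-split : ∀ i j i′ j′ → adjacent i j * adjacent i′ j′ ≡
      adjacent i j * (adjacent i′ j′ * (adjacent i′ j * adjacent i j′))
      + adjacent i j * (adjacent i′ j′ * apart i′ j) + adjacent i j * (adjacent i′ j′ * apart i j′)
    adjacent-split i j i′ j′ = indicator-split (i + j ≤ᵇ suc k) (i′ + j′ ≤ᵇ suc k) (i′ + j ≤ᵇ suc k) (i + j′ ≤ᵇ suc k) nested
      where
      true⇒≤ : ∀ m n → (m ≤ᵇ n) ≡ true → m ≤ n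
      true⇒≤ m n m≤ᵇn = ≤ᵇ⇒≤ m n (subst T (sym m≤ᵇn) _)
      false⇒> : ∀ m n → (m ≤ᵇ n) ≡ false → n < m
      false⇒> m n m≰ᵇn = ≰⇒> λ m≤n → subst T m≰ᵇn (≤⇒≤ᵇ m≤n)
      nested : (i + j ≤ᵇ suc k) ≡ true → (i′ + j′ ≤ᵇ suc k) ≡ true → (i′ + j ≤ᵇ suc k) ≡ false → (i + j′ ≤ᵇ suc k) ≡ false → ⊥
      nested ij i′j′ i′j ij′ =
        <⇒≱ (subst (suc k + suc k <_) (lemma i j i′ j′) (+-mono-< (false⇒> (i′ + j) (suc k) i′j) (false⇒> (i + j′) (suc k) ij′)))
            (+-mono-≤ (true⇒≤ (i + j) (suc k) ij) (true⇒≤ (i′ + j′) (suc k) i′j′))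
        where
        lemma : ∀ i j i′ j′ → (i′ + j) + (i + j′) ≡ (i + j) + (i′ + j′)
        lemma = solve-∀

    Σ₄-+ : ∀ F G → Σ₄ (λ i j i′ j′ → F i j i′ j′ + G i j i′ j′) ≡ Σ₄ F + Σ₄ G
    Σ₄-+ F G = trans (sumRange-cong 1 k λ i → trans (sumRange-cong 1 k λ j → trans (sumRange-cong 1 k λ i′ → sumRange-+ 1 k _ _)
                                                                               (sumRange-+ 1 k _ _))
                                                   (sumRange-+ 1 k _ _))
                     (sumRange-+ 1 k _ _)

    Σ₄-cong : ∀ {F G} → (∀ i j i′ j′ → F i j i′ j′ ≡ G i j i′ j′) → Σ₄ F ≡ Σ₄ G
    Σ₄-cong F≡G = sumRange-cong 1 k λ i → sumRange-cong 1 k λ j → sumRange-cong 1 k λ i′ → sumRange-cong 1 k (F≡G i j i′)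

    Σ₄-flip : ∀ F → Σ₄ F ≡ Σ₄ (λ i j i′ j′ → F i′ j′ i j)
    Σ₄-flip F = begin
      Σ₁ (λ i → Σ₁ λ j → Σ₁ λ i′ → Σ₁ λ j′ → F i j i′ j′)  ≡⟨ sumRange-cong 1 k (λ i → sumRange-comm 1 k 1 k λ j i′ → Σ₁ (F i j i′)) ⟩
      Σ₁ (λ i → Σ₁ λ i′ → Σ₁ λ j → Σ₁ λ j′ → F i j i′ j′)  ≡⟨ sumRange-comm 1 k 1 k (λ i i′ → Σ₁ λ j → Σ₁ λ j′ → F i j i′ j′) ⟩
      Σ₁ (λ i′ → Σ₁ λ i → Σ₁ λ j → Σ₁ λ j′ → F i j i′ j′)  ≡⟨ sumRange-cong 1 k (λ i′ → sumRange-cong 1 k λ i → sumRange-comm 1 k 1 k λ j j′ → F i j i′ j′) ⟩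
      Σ₁ (λ i′ → Σ₁ λ i → Σ₁ λ j′ → Σ₁ λ j → F i j i′ j′)  ≡⟨ sumRange-cong 1 k (λ i′ → sumRange-comm 1 k 1 k λ i j′ → Σ₁ λ j → F i j i′ j′) ⟩
      Σ₁ (λ i′ → Σ₁ λ j′ → Σ₁ λ i → Σ₁ λ j → F i j i′ j′)  ∎
      where open ≡-Reasoning

    Σ₂-square : ∀ (g : ℕ → ℕ → ℕ) → (Σ₁ λ i → Σ₁ (g i)) * (Σ₁ λ i → Σ₁ (g i)) ≡ Σ₄ λ i j i′ j′ → g i j * g i′ j′
    Σ₂-square g = begin
      S * S                                    ≡⟨ sym (sumRange-*ʳ 1 k S λ i → Σ₁ (g i)) ⟩
      Σ₁ (λ i → Σ₁ (g i) * S)                  ≡⟨ sumRange-cong 1 k (λ i → sym (sumRange-*ʳ 1 k S (g i))) ⟩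
      Σ₁ (λ i → Σ₁ λ j → g i j * S)            ≡⟨ sumRange-cong 1 k (λ i → sumRange-cong 1 k λ j → sym (sumRange-*ˡ 1 k (g i j) λ i′ → Σ₁ (g i′))) ⟩
      Σ₁ (λ i → Σ₁ λ j → Σ₁ λ i′ → g i j * Σ₁ (g i′))
                                               ≡⟨ sumRange-cong 1 k (λ i → sumRange-cong 1 k λ j → sumRange-cong 1 k λ i′ → sym (sumRange-*ˡ 1 k (g i j) (g i′))) ⟩
      Σ₄ (λ i j i′ j′ → g i j * g i′ j′)        ∎
      where
      open ≡-Reasoning
      S = Σ₁ λ i → Σ₁ (g i)

    module _ (x y : ℕ → ℕ) where

      entry : ℕ → ℕ → ℕ
      entry p q = if p + q ≤ᵇ suc k then x p * y q else 0

      edgeCount : ℕ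
      edgeCount = Σ₁ λ i → Σ₁ λ j → x i * y j * adjacent i j

      closedWalkCount : ℕ
      closedWalkCount = Σ₄ λ i j i′ j′ → (x i * y j * x i′ * y j′) * (adjacent i j * adjacent i′ j * adjacent i′ j′ * adjacent i j′)

      a₄-sum : ℕ
      a₄-sum = sumFrom 1 to (k ∸ 1) of (λ i →
                 (sumFrom 1 to k of (λ p → entry p (k ∸ i + 1)))
                 * (sumFrom (i + 1) to k of (λ p → sumFrom 1 to (k ∸ i) of (λ q → entry p q))))

      private
        f : ℕ → ℕ → ℕ
        f i j = x i * y j * adjacent i j

        w : ℕ → ℕ → ℕ → ℕ → ℕ
        w i j i′ j′ = x i * y j * x i′ * y j′

      private
        R₁ R₂ : ℕ
        R₁ = Σ₄ λ i j i′ j′ → w i j i′ j′ * (adjacent i j * (adjacent i′ j′ * apart i′ j))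
        R₂ = Σ₄ λ i j i′ j′ → w i j i′ j′ * (adjacent i j * (adjacent i′ j′ * apart i j′))

      edgeCount² : edgeCount * edgeCount ≡ closedWalkCount + R₁ + R₂
      edgeCount² = begin
        edgeCount * edgeCount                  ≡⟨ Σ₂-square f ⟩
        Σ₄ (λ i j i′ j′ → f i j * f i′ j′)     ≡⟨ Σ₄-cong split ⟩
        Σ₄ (λ i j i′ j′ → C i j i′ j′ + D i j i′ j′ + E i j i′ j′)
                                               ≡⟨ Σ₄-+ (λ i j i′ j′ → C i j i′ j′ + D i j i′ j′) E ⟩
        Σ₄ (λ i j i′ j′ → C i j i′ j′ + D i j i′ j′) + R₂
                                               ≡⟨ cong (_+ R₂) (Σ₄-+ C D) ⟩
        closedWalkCount + R₁ + R₂              ∎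
        where
        open ≡-Reasoning
        C D E : ℕ → ℕ → ℕ → ℕ → ℕ
        C i j i′ j′ = w i j i′ j′ * (adjacent i j * adjacent i′ j * adjacent i′ j′ * adjacent i j′)
        D i j i′ j′ = w i j i′ j′ * (adjacent i j * (adjacent i′ j′ * apart i′ j))
        E i j i′ j′ = w i j i′ j′ * (adjacent i j * (adjacent i′ j′ * apart i j′))
        regroup : ∀ a b p c d q → a * b * p * (c * d * q) ≡ a * b * c * d * (p * q)
        regroup = solve-∀
        distribute : ∀ v p q r s d e → v * (p * (q * (r * s)) + d + e) ≡ v * (p * r * q * s) + v * d + v * e
        distribute = solve-∀
        split : ∀ i j i′ j′ → f i j * f i′ j′ ≡ C i j i′ j′ + D i j i′ j′ + E i j i′ j′
        split i j i′ j′ = begin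
          f i j * f i′ j′                                    ≡⟨ regroup (x i) (y j) (adjacent i j) (x i′) (y j′) (adjacent i′ j′) ⟩
          w i j i′ j′ * (adjacent i j * adjacent i′ j′)      ≡⟨ cong (w i j i′ j′ *_) (adjacent-split i j i′ j′) ⟩
          w i j i′ j′ * (adjacent i j * (adjacent i′ j′ * (adjacent i′ j * adjacent i j′))
                         + adjacent i j * (adjacent i′ j′ * apart i′ j) + adjacent i j * (adjacent i′ j′ * apart i j′))
                                                             ≡⟨ distribute (w i j i′ j′) (adjacent i j) (adjacent i′ j′) (adjacent i′ j) (adjacent i j′) _ _ ⟩
          C i j i′ j′ + D i j i′ j′ + E i j i′ j′            ∎

      R₂≡R₁ : R₂ ≡ R₁
      R₂≡R₁ = trans (Σ₄-flip _) (Σ₄-cong λ i j i′ j′ →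
        swap (x i′) (y j′) (x i) (y j) (adjacent i′ j′) (adjacent i j) (apart i′ j))
        where
        swap : ∀ a b c d p q r → a * b * c * d * (p * (q * r)) ≡ c * d * a * b * (q * (p * r))
        swap = solve-∀

      private
        column rest : ℕ → ℕ
        column j = Σ₁ λ i → f i j
        rest j = Σ₁ λ i′ → apart i′ j * Σ₁ (f i′)

      R₁≡Σcolumn*rest : R₁ ≡ Σ₁ λ j → column j * rest j
      R₁≡Σcolumn*rest = begin
        R₁                                          ≡⟨ Σ₄-cong (λ i j i′ j′ → regroup (x i) (y j) (x i′) (y j′) (adjacent i j) (adjacent i′ j′) (apart i′ j)) ⟩
        Σ₄ (λ i j i′ j′ → f i j * (apart i′ j * f i′ j′))
                                                    ≡⟨ sumRange-cong 1 k (λ i → sumRange-cong 1 k λ j → inner i j) ⟩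
        Σ₁ (λ i → Σ₁ λ j → f i j * rest j)          ≡⟨ sumRange-comm 1 k 1 k (λ i j → f i j * rest j) ⟩
        Σ₁ (λ j → Σ₁ λ i → f i j * rest j)          ≡⟨ sumRange-cong 1 k (λ j → sumRange-*ʳ 1 k (rest j) λ i → f i j) ⟩
        Σ₁ (λ j → column j * rest j)                ∎
        where
        open ≡-Reasoning
        regroup : ∀ a b c d p q r → a * b * c * d * (p * (q * r)) ≡ a * b * p * (r * (c * d * q))
        regroup = solve-∀
        inner : ∀ i j → Σ₁ (λ i′ → Σ₁ λ j′ → f i j * (apart i′ j * f i′ j′)) ≡ f i j * rest j
        inner i j = trans (sumRange-cong 1 k λ i′ → trans (sumRange-*ˡ 1 k (f i j) λ j′ → apart i′ j * f i′ j′)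
                                                            (cong (f i j *_) (sumRange-*ˡ 1 k (apart i′ j) (f i′))))
                          (sumRange-*ˡ 1 k (f i j) λ i′ → apart i′ j * Σ₁ (f i′))

      entry≡f : ∀ p q → entry p q ≡ f p q
      entry≡f p q with p + q ≤ᵇ suc k
      ... | true  = sym (*-identityʳ (x p * y q))
      ... | false = sym (*-zeroʳ (x p * y q))

      rest-one : rest 1 ≡ 0
      rest-one = sumRange-zeroᵢ 1 k _ λ i′ _ i′<1+k →
        cong (_* Σ₁ (f i′)) (if-≤ᵇ-yes (subst (_≤ suc k) (+-comm 1 i′) i′<1+k))

      rest-reindex : ∀ s → s ≤ k → rest (k ∸ s + 1) ≡ sumFrom (s + 1) to k of (λ p → sumFrom 1 to (k ∸ s) of (λ q → entry p q))
      rest-reindex s s≤k = begin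
        Σ₁ (λ i′ → apart i′ j * Σ₁ (f i′))
          ≡⟨ cong (λ m → sumRange-aux 1 m (λ i′ → apart i′ j * Σ₁ (f i′))) (sym s+[k∸s]≡k) ⟩
        sumRange-aux 1 (s + (k ∸ s)) (λ i′ → apart i′ j * Σ₁ (f i′))
          ≡⟨ sumRange-++ 1 s (k ∸ s) _ ⟩
        sumRange-aux 1 s (λ i′ → apart i′ j * Σ₁ (f i′)) + sumRange-aux (1 + s) (k ∸ s) (λ i′ → apart i′ j * Σ₁ (f i′))
          ≡⟨ cong₂ _+_ (sumRange-zeroᵢ 1 s _ λ i′ _ i′<1+s → cong (_* Σ₁ (f i′)) (if-≤ᵇ-yes (low i′ i′<1+s)))
                       (sumRange-congᵢ (1 + s) (k ∸ s) λ i′ 1+s≤i′ _ →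
                          trans (cong (_* Σ₁ (f i′)) (if-≤ᵇ-no (high i′ j 1+s≤i′ (≤-reflexive (+-comm 1 (k ∸ s))))))
                                (trans (+-identityʳ _) (row i′ 1+s≤i′))) ⟩
        0 + sumRange-aux (1 + s) (k ∸ s) (λ p → sumRange-aux 1 (k ∸ s) (entry p))
          ≡⟨ cong (λ a → sumRange-aux a (suc k ∸ a) (λ p → sumRange-aux 1 (k ∸ s) (entry p))) (+-comm 1 s) ⟩
        sumRange-aux (s + 1) (suc k ∸ (s + 1)) (λ p → sumRange-aux 1 (k ∸ s) (entry p)) ∎
        where
        open ≡-Reasoning
        j = k ∸ s + 1
        s+[k∸s]≡k : s + (k ∸ s) ≡ k
        s+[k∸s]≡k = m+[n∸m]≡n s≤k
        low : ∀ i′ → i′ < 1 + s → i′ + j ≤ suc k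
        low i′ i′<1+s = subst (i′ + j ≤_) (trans (sym (+-assoc s (k ∸ s) 1)) (trans (cong (_+ 1) s+[k∸s]≡k) (+-comm k 1)))
                              (+-monoˡ-≤ j (s≤s⁻¹ i′<1+s))
        high : ∀ a b → 1 + s ≤ a → 1 + (k ∸ s) ≤ b → suc k < a + b
        high a b 1+s≤a 1+k∸s≤b = subst (_≤ a + b) (trans (cong suc (+-suc s (k ∸ s))) (cong (λ m → suc (suc m)) s+[k∸s]≡k))
                                       (+-mono-≤ 1+s≤a 1+k∸s≤b)
        row : ∀ i′ → 1 + s ≤ i′ → Σ₁ (f i′) ≡ sumRange-aux 1 (k ∸ s) (entry i′)
        row i′ 1+s≤i′ = begin
          Σ₁ (f i′)                                               ≡⟨ cong (λ m → sumRange-aux 1 m (f i′)) (sym (trans (+-comm (k ∸ s) s) s+[k∸s]≡k)) ⟩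
          sumRange-aux 1 ((k ∸ s) + s) (f i′)                     ≡⟨ sumRange-++ 1 (k ∸ s) s (f i′) ⟩
          sumRange-aux 1 (k ∸ s) (f i′) + sumRange-aux (1 + (k ∸ s)) s (f i′)
            ≡⟨ cong₂ _+_ (sumRange-cong 1 (k ∸ s) λ q → sym (entry≡f i′ q))
                         (sumRange-zeroᵢ (1 + (k ∸ s)) s (f i′) λ j′ 1+k∸s≤j′ _ →
                            trans (cong (x i′ * y j′ *_) (if-≤ᵇ-no (high i′ j′ 1+s≤i′ 1+k∸s≤j′))) (*-zeroʳ (x i′ * y j′))) ⟩
          sumRange-aux 1 (k ∸ s) (entry i′) + 0                   ≡⟨ +-identityʳ _ ⟩
          sumRange-aux 1 (k ∸ s) (entry i′)                       ∎

      a₄-sum≡Σcolumn*rest : ∀ k′ → k ≡ suc k′ → a₄-sum ≡ Σ₁ λ j → column j * rest j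
      a₄-sum≡Σcolumn*rest k′ refl = begin
        a₄-sum
          ≡⟨ sumRange-congᵢ 1 k′ (λ s _ s<1+k′ → term s (m≤n⇒m≤1+n (s≤s⁻¹ s<1+k′))) ⟩
        sumRange-aux 1 k′ (λ s → g (suc k ∸ s))
          ≡⟨ sumRange-reflect k′ 1 (suc k) g (m≤n⇒m≤1+n ≤-refl) ⟩
        sumRange-aux (suc (suc k′ ∸ k′)) k′ g
          ≡⟨ cong (λ a → sumRange-aux (suc a) k′ g) (m+n∸n≡m 1 k′) ⟩
        sumRange-aux 2 k′ g
          ≡⟨ sym (cong (_+ sumRange-aux 2 k′ g) (trans (cong (column 1 *_) rest-one) (*-zeroʳ (column 1)))) ⟩
        g 1 + sumRange-aux 2 k′ g ∎
        where
        open ≡-Reasoning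
        g : ℕ → ℕ
        g j = column j * rest j
        term : ∀ s → s ≤ k → (Σ₁ λ p → entry p (k ∸ s + 1)) * sumFrom (s + 1) to k of (λ p → sumFrom 1 to (k ∸ s) of (λ q → entry p q))
                             ≡ g (suc k ∸ s)
        term s s≤k = begin
          (Σ₁ λ p → entry p (k ∸ s + 1)) * sumFrom (s + 1) to k of (λ p → sumFrom 1 to (k ∸ s) of (λ q → entry p q))
            ≡⟨ cong₂ _*_ (sumRange-cong 1 k λ p → entry≡f p (k ∸ s + 1)) (sym (rest-reindex s s≤k)) ⟩
          g (k ∸ s + 1)
            ≡⟨ cong g (trans (+-comm (k ∸ s) 1) (sym (+-∸-assoc 1 s≤k))) ⟩
          g (suc k ∸ s) ∎

      edgeCount-squared : ∀ k′ → k ≡ suc k′ → edgeCount * edgeCount ≡ closedWalkCount + 2 * a₄-sum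
      edgeCount-squared k′ k≡1+k′ = begin
        edgeCount * edgeCount                      ≡⟨ edgeCount² ⟩
        closedWalkCount + R₁ + R₂                  ≡⟨ cong (closedWalkCount + R₁ +_) R₂≡R₁ ⟩
        closedWalkCount + R₁ + R₁                  ≡⟨ cong (λ r → closedWalkCount + r + r) (trans R₁≡Σcolumn*rest (sym (a₄-sum≡Σcolumn*rest k′ k≡1+k′))) ⟩
        closedWalkCount + a₄-sum + a₄-sum          ≡⟨ lemma closedWalkCount a₄-sum ⟩
        closedWalkCount + 2 * a₄-sum               ∎
        where
        open ≡-Reasoning
        lemma : ∀ q r → q + r + r ≡ q + 2 * r
        lemma = solve-∀

  sumFin-cong : ∀ {n} {f g : Fin n → ℕ} → (∀ v → f v ≡ g v) → sumFin f ≡ sumFin g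
  sumFin-cong {zero}  f≡g = refl
  sumFin-cong {suc n} f≡g = cong₂ _+_ (f≡g zero) (sumFin-cong (λ v → f≡g (suc v)))

  sumFin-+ : ∀ {n} (f g : Fin n → ℕ) → sumFin (λ v → f v + g v) ≡ sumFin f + sumFin g
  sumFin-+ {zero}  f g = refl
  sumFin-+ {suc n} f g = trans (cong (f zero + g zero +_) (sumFin-+ (λ v → f (suc v)) (λ v → g (suc v))))
                               (lemma (f zero) (g zero) (sumFin λ v → f (suc v)) (sumFin λ v → g (suc v)))
    where
    lemma : ∀ p q r s → (p + q) + (r + s) ≡ (p + r) + (q + s)
    lemma = solve-∀

  sumFin-*ʳ : ∀ {n} c (f : Fin n → ℕ) → sumFin (λ v → f v * c) ≡ sumFin f * c
  sumFin-*ʳ {zero}  c f = refl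
  sumFin-*ʳ {suc n} c f = trans (cong (f zero * c +_) (sumFin-*ʳ c (λ v → f (suc v))))
                                (sym (*-distribʳ-+ c (f zero) (sumFin λ v → f (suc v))))

  sumFin-sumRange-comm : ∀ {n} a m (f : Fin n → ℕ → ℕ) →
                         sumFin (λ v → sumRange-aux a m (f v)) ≡ sumRange-aux a m (λ i → sumFin λ v → f v i)
  sumFin-sumRange-comm {zero}  a m f = sym (sumRange-zeroᵢ a m _ λ _ _ _ → refl)
  sumFin-sumRange-comm {suc n} a m f = trans (cong (sumRange-aux a m (f zero) +_) (sumFin-sumRange-comm a m (λ v → f (suc v))))
                                             (sym (sumRange-+ a m (f zero) _))

  point : ℕ → ℕ → ℕ
  point t i = if (t ≤ᵇ i) ∧ (i ≤ᵇ t) then 1 else 0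

  point-same : ∀ t → point t t ≡ 1
  point-same t with t ≤ᵇ t | ≤ᵇ-reflects-≤ t t
  ... | true  | _       = refl
  ... | false | ofⁿ t≰t = ⊥-elim (t≰t ≤-refl)

  point-< : ∀ {t i} → t < i → point t i ≡ 0
  point-< {t} {i} t<i = cong (λ b → if b then 1 else 0)
    (trans (cong ((t ≤ᵇ i) ∧_) (≤ᵇ-false t<i)) (∧-zeroʳ (t ≤ᵇ i)))

  point-> : ∀ {t i} → i < t → point t i ≡ 0
  point-> {t} {i} i<t = cong (λ b → if b ∧ (i ≤ᵇ t) then 1 else 0) (≤ᵇ-false i<t)

  sumRange-point : ∀ a m t (g : ℕ → ℕ) → a ≤ t → t < a + m → sumRange-aux a m (λ i → point t i * g i) ≡ g t
  sumRange-point a zero    t g a≤t t<a+0 = ⊥-elim (<⇒≱ (subst (t <_) (+-identityʳ a) t<a+0) a≤t)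
  sumRange-point a (suc m) t g a≤t t<a+m with ≤-<-connex t a
  ... | inj₁ t≤a rewrite ≤-antisym t≤a a≤t = begin
    point a a * g a + sumRange-aux (suc a) m (λ i → point a i * g i)
      ≡⟨ cong₂ _+_ (cong (_* g a) (point-same a)) (sumRange-zeroᵢ (suc a) m _ λ i a<i _ → cong (_* g i) (point-< a<i)) ⟩
    1 * g a + 0 ≡⟨ trans (+-identityʳ (1 * g a)) (*-identityˡ (g a)) ⟩
    g a ∎
    where open ≡-Reasoning
  ... | inj₂ a<t = trans (cong (_+ sumRange-aux (suc a) m (λ i → point t i * g i)) (cong (_* g a) (point-> a<t)))
                         (sumRange-point (suc a) m t g a<t (subst (t <_) (+-suc a m) t<a+m))

  labelAdjacency : ℕ → Side → ℕ → Side → ℕ → ℕ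
  labelAdjacency k sideX i sideY j = adjacent k i j
  labelAdjacency k sideY i sideX j = adjacent k j i
  labelAdjacency k sideX i sideX j = 0
  labelAdjacency k sideY i sideY j = 0

  module _ {n k} {G : Graph n} (L : DiffLabelling k G) where

    private
      membership : Side → Fin n → ℕ → ℕ
      membership s v i = if isSide (side L v) s then point (index L v) i else 0

      byLabel : ∀ (h : Side → ℕ → ℕ) v → h (side L v) (index L v) ≡
        sumRange-aux 1 k (λ i → membership sideX v i * h sideX i) + sumRange-aux 1 k (λ i → membership sideY v i * h sideY i)
      byLabel h v with side L v
      ... | sideX = sym (trans (cong₂ _+_ (sumRange-point 1 k (index L v) (h sideX) (index-pos L v) (s≤s (index-le L v)))
                                          (sumRange-zeroᵢ 1 k _ λ _ _ _ → refl))
                               (+-identityʳ _))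
      ... | sideY = sym (trans (cong (_+ sumRange-aux 1 k (λ i → point (index L v) i * h sideY i)) (sumRange-zeroᵢ 1 k _ λ _ _ _ → refl))
                               (sumRange-point 1 k (index L v) (h sideY) (index-pos L v) (s≤s (index-le L v))))

    sumFin-byLabel : ∀ (h : Side → ℕ → ℕ) → sumFin (λ v → h (side L v) (index L v)) ≡
      sumRange-aux 1 k (λ i → xCount L i * h sideX i) + sumRange-aux 1 k (λ i → yCount L i * h sideY i)
    sumFin-byLabel h = begin
      sumFin (λ v → h (side L v) (index L v))
        ≡⟨ sumFin-cong (byLabel h) ⟩
      sumFin (λ v → sumRange-aux 1 k (λ i → membership sideX v i * h sideX i) + sumRange-aux 1 k (λ i → membership sideY v i * h sideY i))
        ≡⟨ sumFin-+ (λ v → sumRange-aux 1 k λ i → membership sideX v i * h sideX i) (λ v → sumRange-aux 1 k λ i → membership sideY v i * h sideY i) ⟩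
      sumFin (λ v → sumRange-aux 1 k (λ i → membership sideX v i * h sideX i)) + sumFin (λ v → sumRange-aux 1 k (λ i → membership sideY v i * h sideY i))
        ≡⟨ cong₂ _+_ (weigh sideX) (weigh sideY) ⟩
      sumRange-aux 1 k (λ i → xCount L i * h sideX i) + sumRange-aux 1 k (λ i → yCount L i * h sideY i) ∎
      where
      open ≡-Reasoning
      weigh : ∀ s → sumFin (λ v → sumRange-aux 1 k (λ i → membership s v i * h s i))
                    ≡ sumRange-aux 1 k (λ i → sumFin (λ v → membership s v i) * h s i)
      weigh s = trans (sumFin-sumRange-comm 1 k λ v i → membership s v i * h s i)
                      (sumRange-cong 1 k λ i → sumFin-*ʳ (h s i) λ v → membership s v i)

    private
      x y : ℕ → ℕ
      x = xCount L
      y = yCount L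
      φ : Fin n → Fin n → ℕ
      φ u v = labelAdjacency k (side L u) (index L u) (side L v) (index L v)

    sumFin-adjacency : sumFin (λ u → sumFin (φ u)) ≡ 2 * edgeCount k x y
    sumFin-adjacency = begin
      sumFin (λ u → sumFin (φ u))
        ≡⟨ sumFin-cong (λ u → sumFin-byLabel (labelAdjacency k (side L u) (index L u))) ⟩
      sumFin (λ u → degree (side L u) (index L u))
        ≡⟨ sumFin-byLabel degree ⟩
      Σ₁ k (λ i → x i * (Σ₁ k (λ j → x j * 0) + Σ₁ k (λ j → y j * adjacent k i j)))
        + Σ₁ k (λ j → y j * (Σ₁ k (λ i → x i * adjacent k i j) + Σ₁ k (λ i → y i * 0)))
        ≡⟨ cong₂ _+_ (sumRange-cong 1 k λ i → cong (λ z → x i * (z + Σ₁ k (λ j → y j * adjacent k i j))) (no-edges x))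
                     (sumRange-cong 1 k λ j → cong (λ z → y j * (Σ₁ k (λ i → x i * adjacent k i j) + z)) (no-edges y)) ⟩
      Σ₁ k (λ i → x i * (0 + Σ₁ k (λ j → y j * adjacent k i j)))
        + Σ₁ k (λ j → y j * (Σ₁ k (λ i → x i * adjacent k i j) + 0))
        ≡⟨ cong₂ _+_ (sumRange-cong 1 k λ i → trans (sym (sumRange-*ˡ 1 k (x i) _)) (sumRange-cong 1 k λ j → sym (*-assoc (x i) (y j) _)))
                     (trans (sumRange-cong 1 k λ j → trans (cong (y j *_) (+-identityʳ _)) (sym (sumRange-*ˡ 1 k (y j) _)))
                     (trans (sumRange-comm 1 k 1 k λ j i → y j * (x i * adjacent k i j))
                            (sumRange-cong 1 k λ i → sumRange-cong 1 k λ j → regroup (y j) (x i) (adjacent k i j)))) ⟩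
      edgeCount k x y + edgeCount k x y
        ≡⟨ cong (edgeCount k x y +_) (sym (+-identityʳ _)) ⟩
      2 * edgeCount k x y ∎
      where
      open ≡-Reasoning
      degree : Side → ℕ → ℕ
      degree s i = Σ₁ k (λ j → x j * labelAdjacency k s i sideX j) + Σ₁ k (λ j → y j * labelAdjacency k s i sideY j)
      no-edges : ∀ (z : ℕ → ℕ) → Σ₁ k (λ j → z j * 0) ≡ 0
      no-edges z = sumRange-zeroᵢ 1 k _ λ j _ _ → *-zeroʳ (z j)
      regroup : ∀ a b c → a * (b * c) ≡ b * a * c
      regroup = solve-∀

    commonNeighbours : Side → ℕ → Side → ℕ → ℕ
    commonNeighbours s i s′ j = Σ₁ k (λ m → x m * (labelAdjacency k s i sideX m * labelAdjacency k sideX m s′ j))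
                              + Σ₁ k (λ m → y m * (labelAdjacency k s i sideY m * labelAdjacency k sideY m s′ j))

    sumFin-commonNeighbours : ∀ a c → sumFin (λ b → φ a b * φ b c) ≡
                              commonNeighbours (side L a) (index L a) (side L c) (index L c)
    sumFin-commonNeighbours a c =
      sumFin-byLabel λ s m → labelAdjacency k (side L a) (index L a) s m * labelAdjacency k s m (side L c) (index L c)

    sumFin-commonNeighbours² : sumFin (λ a → sumFin λ c → commonNeighbours (side L a) (index L a) (side L c) (index L c)
                                                       * commonNeighbours (side L a) (index L a) (side L c) (index L c))
                               ≡ 2 * closedWalkCount k x y
    sumFin-commonNeighbours² = begin
      sumFin (λ a → sumFin λ c → C (side L a) (index L a) (side L c) (index L c) * C (side L a) (index L a) (side L c) (index L c))
        ≡⟨ sumFin-cong (λ a → sumFin-byLabel λ s j → C (side L a) (index L a) s j * C (side L a) (index L a) s j) ⟩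
      sumFin (λ a → squares (side L a) (index L a))
        ≡⟨ sumFin-byLabel squares ⟩
      Σ₁ k (λ i → x i * (Σ₁ k (λ i′ → x i′ * (C sideX i sideX i′ * C sideX i sideX i′)) + Σ₁ k (λ j → y j * (C sideX i sideY j * C sideX i sideY j))))
        + Σ₁ k (λ j → y j * (Σ₁ k (λ i → x i * (C sideY j sideX i * C sideY j sideX i)) + Σ₁ k (λ j′ → y j′ * (C sideY j sideY j′ * C sideY j sideY j′))))
        ≡⟨ cong₂ _+_ (sumRange-cong 1 k λ i → cong (x i *_) (trans (cong (Σ₁ k (λ i′ → x i′ * (C sideX i sideX i′ * C sideX i sideX i′)) +_) (sumRange-zeroᵢ 1 k _ λ j _ _ → trans (cong (λ c → y j * (c * c)) (XY i j)) (*-zeroʳ (y j))))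
                                                                   (+-identityʳ _)))
                     (sumRange-cong 1 k λ j → cong (y j *_) (cong (_+ Σ₁ k (λ j′ → y j′ * (C sideY j sideY j′ * C sideY j sideY j′))) (sumRange-zeroᵢ 1 k _ λ i _ _ → trans (cong (λ c → x i * (c * c)) (YX j i)) (*-zeroʳ (x i))))) ⟩
      Σ₁ k (λ i → x i * Σ₁ k (λ i′ → x i′ * (C sideX i sideX i′ * C sideX i sideX i′)))
        + Σ₁ k (λ j → y j * Σ₁ k (λ j′ → y j′ * (C sideY j sideY j′ * C sideY j sideY j′)))
        ≡⟨ cong₂ _+_ walksFromX walksFromY ⟩
      closedWalkCount k x y + closedWalkCount k x y
        ≡⟨ cong (closedWalkCount k x y +_) (sym (+-identityʳ _)) ⟩
      2 * closedWalkCount k x y ∎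
      where
      open ≡-Reasoning
      C = commonNeighbours
      squares : Side → ℕ → ℕ
      squares s i = Σ₁ k (λ i′ → x i′ * (C s i sideX i′ * C s i sideX i′)) + Σ₁ k (λ j → y j * (C s i sideY j * C s i sideY j))
      XY : ∀ i j → C sideX i sideY j ≡ 0
      XY i j = cong₂ _+_ (sumRange-zeroᵢ 1 k _ λ m _ _ → *-zeroʳ (x m))
                         (sumRange-zeroᵢ 1 k _ λ m _ _ → trans (cong (y m *_) (*-zeroʳ (adjacent k i m))) (*-zeroʳ (y m)))
      YX : ∀ j i → C sideY j sideX i ≡ 0
      YX j i = cong₂ _+_ (sumRange-zeroᵢ 1 k _ λ m _ _ → trans (cong (x m *_) (*-zeroʳ (adjacent k m j))) (*-zeroʳ (x m)))
                         (sumRange-zeroᵢ 1 k _ λ m _ _ → *-zeroʳ (y m))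
      XX : ∀ i i′ → C sideX i sideX i′ ≡ Σ₁ k (λ m → y m * (adjacent k i m * adjacent k i′ m))
      XX i i′ = cong (_+ Σ₁ k (λ m → y m * (adjacent k i m * adjacent k i′ m))) (sumRange-zeroᵢ 1 k _ λ m _ _ → *-zeroʳ (x m))
      YY : ∀ j j′ → C sideY j sideY j′ ≡ Σ₁ k (λ m → x m * (adjacent k m j * adjacent k m j′))
      YY j j′ = trans (cong (Σ₁ k (λ m → x m * (adjacent k m j * adjacent k m j′)) +_) (sumRange-zeroᵢ 1 k _ λ m _ _ → *-zeroʳ (y m)))
                      (+-identityʳ _)
      regroupX : ∀ a a′ b b′ p q r s → a * (a′ * (b * (p * q) * (b′ * (r * s)))) ≡ a * b * a′ * b′ * (p * q * s * r)
      regroupX = solve-∀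
      walksFromX : Σ₁ k (λ i → x i * Σ₁ k (λ i′ → x i′ * (C sideX i sideX i′ * C sideX i sideX i′))) ≡ closedWalkCount k x y
      walksFromX = begin
        Σ₁ k (λ i → x i * Σ₁ k (λ i′ → x i′ * (C sideX i sideX i′ * C sideX i sideX i′)))
          ≡⟨ sumRange-cong 1 k (λ i → cong (x i *_) (sumRange-cong 1 k λ i′ → cong (λ c → x i′ * (c * c)) (XX i i′))) ⟩
        Σ₁ k (λ i → x i * Σ₁ k (λ i′ → x i′ * (Σ₁ k (λ m → y m * (adjacent k i m * adjacent k i′ m)) * Σ₁ k (λ m → y m * (adjacent k i m * adjacent k i′ m)))))
          ≡⟨ Σ₂-weighted-square k x (λ i i′ m → y m * (adjacent k i m * adjacent k i′ m)) ⟩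
        Σ₄ k (λ i i′ j j′ → x i * (x i′ * (y j * (adjacent k i j * adjacent k i′ j) * (y j′ * (adjacent k i j′ * adjacent k i′ j′)))))
          ≡⟨ Σ₄-swap₂₃ k _ ⟩
        Σ₄ k (λ i j i′ j′ → x i * (x i′ * (y j * (adjacent k i j * adjacent k i′ j) * (y j′ * (adjacent k i j′ * adjacent k i′ j′)))))
          ≡⟨ Σ₄-cong k (λ i j i′ j′ → regroupX (x i) (x i′) (y j) (y j′) (adjacent k i j) (adjacent k i′ j) (adjacent k i j′) (adjacent k i′ j′)) ⟩
        closedWalkCount k x y ∎
      regroupY : ∀ b b′ a a′ p q r s → b * (b′ * (a * (p * q) * (a′ * (r * s)))) ≡ a * b * a′ * b′ * (p * r * s * q)
      regroupY = solve-∀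
      walksFromY : Σ₁ k (λ j → y j * Σ₁ k (λ j′ → y j′ * (C sideY j sideY j′ * C sideY j sideY j′))) ≡ closedWalkCount k x y
      walksFromY = begin
        Σ₁ k (λ j → y j * Σ₁ k (λ j′ → y j′ * (C sideY j sideY j′ * C sideY j sideY j′)))
          ≡⟨ sumRange-cong 1 k (λ j → cong (y j *_) (sumRange-cong 1 k λ j′ → cong (λ c → y j′ * (c * c)) (YY j j′))) ⟩
        Σ₁ k (λ j → y j * Σ₁ k (λ j′ → y j′ * (Σ₁ k (λ m → x m * (adjacent k m j * adjacent k m j′)) * Σ₁ k (λ m → x m * (adjacent k m j * adjacent k m j′)))))
          ≡⟨ Σ₂-weighted-square k y (λ j j′ m → x m * (adjacent k m j * adjacent k m j′)) ⟩
        Σ₄ k (λ j j′ i i′ → y j * (y j′ * (x i * (adjacent k i j * adjacent k i j′) * (x i′ * (adjacent k i′ j * adjacent k i′ j′)))))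
          ≡⟨ Σ₄-flip k _ ⟩
        Σ₄ k (λ i i′ j j′ → y j * (y j′ * (x i * (adjacent k i j * adjacent k i j′) * (x i′ * (adjacent k i′ j * adjacent k i′ j′)))))
          ≡⟨ Σ₄-swap₂₃ k _ ⟩
        Σ₄ k (λ i j i′ j′ → y j * (y j′ * (x i * (adjacent k i j * adjacent k i j′) * (x i′ * (adjacent k i′ j * adjacent k i′ j′)))))
          ≡⟨ Σ₄-cong k (λ i j i′ j′ → regroupY (y j) (y j′) (x i) (x i′) (adjacent k i j) (adjacent k i j′) (adjacent k i′ j) (adjacent k i′ j′)) ⟩
        closedWalkCount k x y ∎

open import Data.Bool using (true; false; if_then_else_)
open import Data.Empty using (⊥-elim)
open import Data.Fin using (Fin; zero; suc)
open import Data.Integer as ℤ using (+_)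
import Data.Integer.Properties as ℤ
open import Data.Integer.Tactic.RingSolver using (solve-∀)
open import Data.Nat using (ℕ; zero; suc; _≤_; _+_; _*_; _∸_; s≤s; z≤n)
import Data.Nat.Properties as ℕ
open import Data.Product using (_×_; _,_)
open import Data.Sum using (inj₁; inj₂)
open import Function using (_∘_)
open import Function.Bundles using (Equivalence)
open import Relation.Binary.PropositionalEquality
open import Relation.Nullary using (¬_; contradiction)

open import Algebra.Properties.Semiring.Sum ℤ.+-*-semiring using (sum; sum-cong-≋; ∑-comm; *-distribˡ-sum; *-distribʳ-sum)

open import Defs using (Graph; adj; adjMatrix; a; sumFin; sumFrom_to_of_; Side; sideX; sideY;
                       DiffLabelling; side; index; adj-iff; xCount; yCount; charMat)
open CharacteristicPolynomial using (∑²; closedWalks₄; twentyFour-a₄; adjMatrix-sym)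
open DifferenceGraphCounting using (labelAdjacency; if-≤ᵇ-yes; if-≤ᵇ-no; edgeCount; closedWalkCount; a₄-sum; edgeCount-squared;
                      sumFin-adjacency; commonNeighbours; sumFin-commonNeighbours; sumFin-commonNeighbours²)

sum-pos : ∀ {n} (f : Fin n → ℕ) → sum (λ v → + f v) ≡ + sumFin f
sum-pos {zero}  f = refl
sum-pos {suc n} f = trans (cong (λ s → + f zero ℤ.+ s) (sum-pos (f ∘ suc))) (sym (ℤ.pos-+ (f zero) (sumFin (f ∘ suc))))

module _ {n k} {G : Graph n} (L : DiffLabelling k G) where

  private
    φ : Fin n → Fin n → ℕ
    φ u v = labelAdjacency k (side L u) (index L u) (side L v) (index L v)
    x y : ℕ → ℕ
    x = xCount L
    y = yCount L

  adjacency-byLabel : ∀ u v → (if adj G u v then 1 else 0) ≡ φ u v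
  adjacency-byLabel u v with adj G u v | adj-iff L u v
  ... | true  | u~v = edge (side L u) (side L v) (Equivalence.to u~v refl)
    where
    edge : ∀ s s′ → s ≢ s′ × index L u + index L v ≤ suc k → 1 ≡ labelAdjacency k s (index L u) s′ (index L v)
    edge sideX sideX (s≢s′ , _) = ⊥-elim (s≢s′ refl)
    edge sideY sideY (s≢s′ , _) = ⊥-elim (s≢s′ refl)
    edge sideX sideY (_ , i+j≤K) = sym (if-≤ᵇ-yes i+j≤K)
    edge sideY sideX (_ , i+j≤K) = sym (if-≤ᵇ-yes (subst (_≤ suc k) (ℕ.+-comm (index L u) (index L v)) i+j≤K))
  ... | false | u~v = nonEdge (side L u) (side L v) λ p → contradiction (Equivalence.from u~v p) λ ()
    where
    nonEdge : ∀ s s′ → ¬ (s ≢ s′ × index L u + index L v ≤ suc k) → 0 ≡ labelAdjacency k s (index L u) s′ (index L v)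
    nonEdge sideX sideX _ = refl
    nonEdge sideY sideY _ = refl
    nonEdge sideX sideY no-edge with ℕ.≤-<-connex (index L u + index L v) (suc k)
    ... | inj₁ i+j≤K = ⊥-elim (no-edge ((λ ()) , i+j≤K))
    ... | inj₂ K<i+j = sym (if-≤ᵇ-no K<i+j)
    nonEdge sideY sideX no-edge with ℕ.≤-<-connex (index L v + index L u) (suc k)
    ... | inj₁ j+i≤K = ⊥-elim (no-edge ((λ ()) , subst (_≤ suc k) (ℕ.+-comm (index L v) (index L u)) j+i≤K))
    ... | inj₂ K<j+i = sym (if-≤ᵇ-no K<j+i)

  adjMatrix-byLabel : ∀ u v → adjMatrix G u v ≡ + φ u v
  adjMatrix-byLabel u v = trans (if-pos (adj G u v)) (cong +_ (adjacency-byLabel u v))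
    where
    if-pos : ∀ b → (if b then + 1 else + 0) ≡ + (if b then 1 else 0)
    if-pos true  = refl
    if-pos false = refl

  ∑²-adjMatrix : ∑² (adjMatrix G) ≡ + (2 * edgeCount k x y)
  ∑²-adjMatrix = begin
    sum (λ u → sum (adjMatrix G u))   ≡⟨ sum-cong-≋ (λ u → trans (sum-cong-≋ (adjMatrix-byLabel u)) (sum-pos (φ u))) ⟩
    sum (λ u → + sumFin (φ u))        ≡⟨ sum-pos (λ u → sumFin (φ u)) ⟩
    + sumFin (λ u → sumFin (φ u))     ≡⟨ cong +_ (sumFin-adjacency L) ⟩
    + (2 * edgeCount k x y)           ∎
    where open ≡-Reasoning

  closedWalks₄-adjMatrix : closedWalks₄ (adjMatrix G) ≡ + (2 * closedWalkCount k x y)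
  closedWalks₄-adjMatrix = begin
    sum (λ a → sum λ b → sum λ c → sum λ d → A a b ℤ.* A b c ℤ.* A c d ℤ.* A d a)
      ≡⟨ sum-cong-≋ (λ a → ∑-comm λ b c → sum λ d → A a b ℤ.* A b c ℤ.* A c d ℤ.* A d a) ⟩
    sum (λ a → sum λ c → sum λ b → sum λ d → A a b ℤ.* A b c ℤ.* A c d ℤ.* A d a)
      ≡⟨ sum-cong-≋ (λ a → sum-cong-≋ λ c → walks-through a c) ⟩
    sum (λ a → sum λ c → + (C a c * C a c))
      ≡⟨ sum-cong-≋ (λ a → sum-pos (λ c → C a c * C a c)) ⟩
    sum (λ a → + sumFin λ c → C a c * C a c)
      ≡⟨ sum-pos (λ a → sumFin λ c → C a c * C a c) ⟩
    + sumFin (λ a → sumFin λ c → C a c * C a c)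
      ≡⟨ cong +_ (sumFin-commonNeighbours² L) ⟩
    + (2 * closedWalkCount k x y) ∎
    where
    open ≡-Reasoning
    A = adjMatrix G
    C : Fin n → Fin n → ℕ
    C a c = commonNeighbours L (side L a) (index L a) (side L c) (index L c)
    regroup : ∀ p q r s → p ℤ.* q ℤ.* r ℤ.* s ≡ (p ℤ.* q) ℤ.* (s ℤ.* r)
    regroup = solve-∀
    paths : ∀ a c → sum (λ b → A a b ℤ.* A b c) ≡ + C a c
    paths a c = begin
      sum (λ b → A a b ℤ.* A b c)        ≡⟨ sum-cong-≋ (λ b → trans (cong₂ ℤ._*_ (adjMatrix-byLabel a b) (adjMatrix-byLabel b c))
                                                                    (sym (ℤ.pos-* (φ a b) (φ b c)))) ⟩
      sum (λ b → + (φ a b * φ b c))      ≡⟨ sum-pos (λ b → φ a b * φ b c) ⟩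
      + sumFin (λ b → φ a b * φ b c)     ≡⟨ cong +_ (sumFin-commonNeighbours L a c) ⟩
      + C a c                            ∎
    walks-through : ∀ a c → sum (λ b → sum λ d → A a b ℤ.* A b c ℤ.* A c d ℤ.* A d a) ≡ + (C a c * C a c)
    walks-through a c = begin
      sum (λ b → sum λ d → A a b ℤ.* A b c ℤ.* A c d ℤ.* A d a)
        ≡⟨ sum-cong-≋ (λ b → sum-cong-≋ λ d → trans (cong₂ (λ p q → A a b ℤ.* A b c ℤ.* p ℤ.* q) (adjMatrix-sym G c d) (adjMatrix-sym G d a))
                                                      (regroup (A a b) (A b c) (A d c) (A a d))) ⟩
      sum (λ b → sum λ d → (A a b ℤ.* A b c) ℤ.* (A a d ℤ.* A d c))
        ≡⟨ sum-cong-≋ (λ b → sym (*-distribˡ-sum (A a b ℤ.* A b c) λ d → A a d ℤ.* A d c)) ⟩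
      sum (λ b → (A a b ℤ.* A b c) ℤ.* sum (λ d → A a d ℤ.* A d c))
        ≡⟨ sym (*-distribʳ-sum (sum λ d → A a d ℤ.* A d c) λ b → A a b ℤ.* A b c) ⟩
      sum (λ b → A a b ℤ.* A b c) ℤ.* sum (λ d → A a d ℤ.* A d c)
        ≡⟨ cong₂ ℤ._*_ (paths a c) (paths a c) ⟩
      + C a c ℤ.* + C a c
        ≡⟨ sym (ℤ.pos-* (C a c) (C a c)) ⟩
      + (C a c * C a c) ∎

twentyFour-identity : ∀ p q r → p ℤ.* p ≡ q ℤ.+ + 2 ℤ.* r →
                      + 3 ℤ.* ((+ 2 ℤ.* p) ℤ.* (+ 2 ℤ.* p)) ℤ.- + 6 ℤ.* (+ 2 ℤ.* q) ≡ + 24 ℤ.* r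
twentyFour-identity p q r p²≡q+2r = begin
  + 3 ℤ.* ((+ 2 ℤ.* p) ℤ.* (+ 2 ℤ.* p)) ℤ.- + 6 ℤ.* (+ 2 ℤ.* q) ≡⟨ expand p q ⟩
  + 12 ℤ.* (p ℤ.* p) ℤ.- + 12 ℤ.* q                          ≡⟨ cong (λ s → + 12 ℤ.* s ℤ.- + 12 ℤ.* q) p²≡q+2r ⟩
  + 12 ℤ.* (q ℤ.+ + 2 ℤ.* r) ℤ.- + 12 ℤ.* q                  ≡⟨ collect q r ⟩
  + 24 ℤ.* r                                                 ∎
  where
  open ≡-Reasoning
  expand : ∀ p q → + 3 ℤ.* ((+ 2 ℤ.* p) ℤ.* (+ 2 ℤ.* p)) ℤ.- + 6 ℤ.* (+ 2 ℤ.* q) ≡ + 12 ℤ.* (p ℤ.* p) ℤ.- + 12 ℤ.* q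
  expand = solve-∀
  collect : ∀ q r → + 12 ℤ.* (q ℤ.+ + 2 ℤ.* r) ℤ.- + 12 ℤ.* q ≡ + 24 ℤ.* r
  collect = solve-∀

theorem4p5 : (n k : ℕ) → 1 ≤ k → (G : Graph n) → (L : DiffLabelling k G) →
    a 4 G ≡ + (sumFrom 1 to (k ∸ 1) of (λ i →
    (sumFrom 1 to k of (λ p → charMat L p (k ∸ i + 1)))
    * (sumFrom (i + 1) to k of (λ p → sumFrom 1 to (k ∸ i) of (λ q → charMat L p q)))))
theorem4p5 n (suc k′) (s≤s z≤n) G L = ℤ.*-cancelˡ-≡ (+ 24) (a 4 G) (+ R) (begin
  + 24 ℤ.* a 4 G
    ≡⟨ twentyFour-a₄ G ⟩
  + 3 ℤ.* (∑² (adjMatrix G) ℤ.* ∑² (adjMatrix G)) ℤ.- + 6 ℤ.* closedWalks₄ (adjMatrix G)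
    ≡⟨ cong₂ (λ s w → + 3 ℤ.* (s ℤ.* s) ℤ.- + 6 ℤ.* w)
             (trans (∑²-adjMatrix L) (ℤ.pos-* 2 P)) (trans (closedWalks₄-adjMatrix L) (ℤ.pos-* 2 Q)) ⟩
  + 3 ℤ.* ((+ 2 ℤ.* + P) ℤ.* (+ 2 ℤ.* + P)) ℤ.- + 6 ℤ.* (+ 2 ℤ.* + Q)
    ≡⟨ twentyFour-identity (+ P) (+ Q) (+ R) P²≡Q+2R ⟩
  + 24 ℤ.* + R ∎)
  where
  open ≡-Reasoning
  x y : ℕ → ℕ
  x = xCount L
  y = yCount L
  P = edgeCount (suc k′) x y
  Q = closedWalkCount (suc k′) x y
  R = a₄-sum (suc k′) x y
  P²≡Q+2R : + P ℤ.* + P ≡ + Q ℤ.+ + 2 ℤ.* + R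
  P²≡Q+2R = begin
    + P ℤ.* + P          ≡⟨ sym (ℤ.pos-* P P) ⟩
    + (P * P)            ≡⟨ cong +_ (edgeCount-squared (suc k′) x y k′ refl) ⟩
    + (Q + 2 * R)        ≡⟨ ℤ.pos-+ Q (2 * R) ⟩
    + Q ℤ.+ + (2 * R)    ≡⟨ cong (λ s → + Q ℤ.+ s) (ℤ.pos-* 2 R) ⟩
    + Q ℤ.+ + 2 ℤ.* + R  ∎
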